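{- Let $f$ be any honest function and let $b\geq 2$ be any base. Then the base-$b$ sum approximation from below $\hat{A}^{\alpha^f}_b$ of $\alpha^f$ is elementary.
   Context: A function $\phi$ is elementary if it can be generated from the initial functions $2^x$, $\max$, $0$, $S$ (successor) and the projections $I^n_i$ by composition and bounded primitive recursion; a relation is elementary if its characteristic function is. Rationals are coded into $\mathbb{N}$ in a standard elementary way. A function $f:\mathbb{N}\to\mathbb{N}$ is honest if $f(x)\le f(x+1)$, $f(x)\geq 2^x$ for all $x$, and the relation $f(x)=y$ is elementary. Let $P_i$ denote the $i$-th prime ($P_0=2,P_1=3,\dots$). Define $g(0)=1$ and $g(j+1)=P_j^{2(j+2)(g(j)+1)^3}$. For an honest $f$ let $h(i)=g(f(i)+i)$, $\alpha^f_n=\sum_{i=0}^n P_i^{ -h(i)}$ and $\alpha^f=\lim_{n\to\infty}\alpha^f_n$ (an irrational number in $(0,1)$). For an irrational $\alpha\in(0,1)$ and base $b\ge2$, write uniquely $\alpha=\sum_{i=1}^\infty\mathtt{D}_ib^{ -k_i}$ with $\mathtt{D}_i\in\{1,\dots,b-1\}$ and $0<k_1<k_2<\cdots$; then $\hat{A}^\alpha_b(0)=0$ and $\hat{A}^\alpha_b(i)=\mathtt{D}_ib^{ -k_i}$ for $i>0$. -}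

module Defs where

open import Data.Nat using (ℕ; zero; suc; _+_; _*_; _^_; _≤_; _<_; _⊔_; _!; _≡ᵇ_)
open import Data.Nat.DivMod using () renaming (_/_ to _div_)
open import Data.Nat.Primality using (prime?)
open import Data.Bool using (if_then_else_)
open import Data.Fin using (Fin) renaming (zero to fz; suc to fs)
open import Data.Vec.Functional using (Vector; _∷_)
open import Data.Integer as ℤ using (ℤ; +_; -[1+_])
open import Data.Rational as ℚ using (ℚ; 0ℚ; 1ℚ; ↥_)
open import Data.Product using (Σ; Σ-syntax; _×_)
open import Relation.Nullary using (does)
open import Relation.Binary.PropositionalEquality using (_≡_)

-- The class is closed under
-- pointwise equality (functions are taken extensionally).

data Elem : (k : ℕ) → (Vector ℕ k → ℕ) → Set where
  e-exp  : Elem 1 (λ x → 2 ^ x fz)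
  e-max  : Elem 2 (λ x → x fz ⊔ x (fs fz))
  e-zero : Elem 0 (λ _ → 0)
  e-suc  : Elem 1 (λ x → suc (x fz))
  e-proj : ∀ {k} (i : Fin k) → Elem k (λ x → x i)
  e-comp : ∀ {m k} {F : Vector ℕ m → ℕ} {G : Fin m → Vector ℕ k → ℕ} →
           Elem m F → ((i : Fin m) → Elem k (G i)) →
           Elem k (λ x → F (λ i → G i x))
  e-brec : ∀ {k} {G : Vector ℕ k → ℕ} {H : Vector ℕ (suc (suc k)) → ℕ}
             {J : Vector ℕ (suc k) → ℕ} (F : Vector ℕ (suc k) → ℕ) →
           Elem k G → Elem (suc (suc k)) H → Elem (suc k) J →
           (∀ x → F (0 ∷ x) ≡ G x) →
           (∀ y x → F (suc y ∷ x) ≡ H (y ∷ F (y ∷ x) ∷ x)) →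
           (∀ x → F x ≤ J x) →
           Elem (suc k) F
  e-ext  : ∀ {k} {F G : Vector ℕ k → ℕ} → Elem k F → (∀ x → F x ≡ G x) → Elem k G

Elementary₁ : (ℕ → ℕ) → Set
Elementary₁ φ = Elem 1 (λ x → φ (x fz))

graphχ : (ℕ → ℕ) → Vector ℕ 2 → ℕ
graphχ f x = if f (x fz) ≡ᵇ x (fs fz) then 1 else 0

Honest : (ℕ → ℕ) → Set
Honest f = (∀ x → f x ≤ f (suc x)) × (∀ x → 2 ^ x ≤ f x) × Elem 2 (graphχ f)

-- Coding of rationals into ℕ: Cantor pairing of (zig-zag code of the
-- numerator, denominator - 1) of the reduced fraction.

cantor : ℕ → ℕ → ℕ
cantor a b = ((a + b) * (a + b + 1)) div 2 + a

codeℤ : ℤ → ℕ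
codeℤ (+ n)      = 2 * n
codeℤ -[1+ n ]   = 2 * n + 1

codeℚ : ℚ → ℕ
codeℚ q = cantor (codeℤ (↥ q)) (ℚ.ℚ.denominator-1 q)

-- Primes: P 0 = 2, P (i+1) = least prime > P i
-- (searched in (p, p! + 1], where one always exists by Euclid).

searchPrime : ℕ → ℕ → ℕ
searchPrime zero    s = s
searchPrime (suc k) s = if does (prime? s) then s else searchPrime k (suc s)

nextPrime : ℕ → ℕ
nextPrime p = searchPrime (p ! + 1) (suc p)

P : ℕ → ℕ
P zero    = 2
P (suc i) = nextPrime (P i)

g : ℕ → ℕ
g zero    = 1
g (suc j) = P j ^ (2 * (j + 2) * (g j + 1) ^ 3)

h : (ℕ → ℕ) → ℕ → ℕ
h f i = g (f i + i)

-- 1/n for n ≠ 0 (only ever applied to nonzero arguments; recip 0 = 0)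
recip : ℕ → ℚ
recip zero    = 0ℚ
recip (suc n) = + 1 ℚ./ suc n

sumTo : (ℕ → ℚ) → ℕ → ℚ
sumTo t zero    = t 0
sumTo t (suc n) = sumTo t n ℚ.+ t (suc n)

alpha : (ℕ → ℕ) → ℕ → ℚ
alpha f = sumTo (λ i → recip (P i ^ h f i))

-- For nondecreasing bounded rational sequences a, s: lim a = lim s
-- (i.e. sup a ≤ sup s and sup s ≤ sup a).
SupLe : (ℕ → ℚ) → (ℕ → ℚ) → Set
SupLe a s = ∀ n (ε : ℚ) → 0ℚ ℚ.< ε → Σ[ N ∈ ℕ ] (a n ℚ.≤ s N ℚ.+ ε)

SameLimit : (ℕ → ℚ) → (ℕ → ℚ) → Set
SameLimit a s = SupLe a s × SupLe s a

-- A is the base-b sum approximation from below Â^α_b of the real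
-- α = lim a (a nondecreasing):  A 0 = 0, A i = D_i b^{-k_i} (i ≥ 1) where
-- α = Σ_{i≥1} D_i b^{-k_i}, D_i ∈ {1,…,b-1}, 0 < k_1 < k_2 < ⋯ .
IsSumApproxBelow : (ℕ → ℚ) → ℕ → (ℕ → ℚ) → Set
IsSumApproxBelow a b A =
  (A 0 ≡ 0ℚ) ×
  Σ[ D ∈ (ℕ → ℕ) ] Σ[ k ∈ (ℕ → ℕ) ]
    ((∀ i → 1 ≤ i → 1 ≤ D i × D i < b) ×
     (0 < k 1) ×
     (∀ i → 1 ≤ i → k i < k (suc i)) ×
     (∀ i → 1 ≤ i → A i ≡ (+ D i ℚ./ 1) ℚ.* recip (b ^ k i)) ×
     SameLimit a (sumTo A))

-- Write alpha f n = N n / Q n, where Q n is the product of the R i = P i ^ h f i for i ≤ n.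
-- Since R (1+n) ≥ (Q n)², the tail of α^f after n is tiny next to 1 / Q n, so ⌊bᵐ * N n / Q n⌋
-- is constant, and equal to ⌊bᵐ α^f⌋, from the first n with bᵐ * Q n < R (1+n) on; that n is
-- below bᵐ, and all the Q n before it are bounded by b³ᵐ + R 0. Hence ⌊bᵐ α^f⌋ and the m-th
-- base-b digit of α^f are elementary in m. Nonzero digits cannot be far apart: the prime P b
-- divides Q n but not N n for n ≥ b, which keeps bᵐ * N n − ⌊bᵐ α^f⌋ * Q n positive, and a run of
-- 3m + R 0 + Q b zeros after position m would make it too small. So the position of the i-th
-- nonzero digit comes from a bounded search and is below an exponential in i. The functions of f
-- are evaluated capped by an elementary bound (x ⊓ c), for which the elementary graph of f suffices.

module Submission where

open import Defs
open import Data.Nat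
open import Data.Nat.Properties
open import Data.Nat.DivMod
open import Data.Nat.Divisibility
open import Data.Nat.GCD
open import Data.Nat.Coprimality using (Coprime; coprime-/gcd)
open import Data.Nat.Primality
open import Data.Nat.Tactic.RingSolver using (solve-∀)
open import Data.Bool using (T; true; false; if_then_else_)
open import Data.Fin using (Fin) renaming (zero to fz; suc to fs)
open import Data.Vec.Functional using (Vector; _∷_; tail)
import Data.Integer as ℤ
import Data.Integer.Properties as ℤP
open import Data.Rational as ℚ using (ℚ; 0ℚ)
import Data.Rational.Properties as ℚP
import Data.Rational.Unnormalised as ℚᵘ
import Data.Rational.Unnormalised.Properties as ℚᵘP
open import Data.Product using (Σ-syntax; _×_; _,_; proj₁; proj₂)
open import Data.Sum using (inj₁; inj₂)
open import Data.Empty using (⊥-elim)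
open import Relation.Nullary using (¬_; yes; no)
open import Relation.Binary using (tri<; tri≈; tri>)
open import Relation.Binary.PropositionalEquality

-- Curried elementary functions of small arity; records rather than definitions, so that φ can be inferred.

record Elem₁ (φ : ℕ → ℕ) : Set where
  constructor elem₁
  field un₁ : Elem 1 (λ v → φ (v fz))

record Elem₂ (φ : ℕ → ℕ → ℕ) : Set where
  constructor elem₂
  field un₂ : Elem 2 (λ v → φ (v fz) (v (fs fz)))

record Elem₃ (φ : ℕ → ℕ → ℕ → ℕ) : Set where
  constructor elem₃
  field un₃ : Elem 3 (λ v → φ (v fz) (v (fs fz)) (v (fs (fs fz))))

open Elem₂ using (un₂)

app₁ : ∀ {k φ} {F : Vector ℕ k → ℕ} → Elem₁ φ → Elem k F → Elem k (λ x → φ (F x))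
app₁ (elem₁ e) F = e-comp e (λ _ → F)

app₂ : ∀ {k φ} {F G : Vector ℕ k → ℕ} → Elem₂ φ → Elem k F → Elem k G →
       Elem k (λ x → φ (F x) (G x))
app₂ {k} {F = F} {G} (elem₂ e) eF eG = e-comp {G = args} e elemArgs
  where
  args : Fin 2 → Vector ℕ k → ℕ
  args fz     = F
  args (fs _) = G
  elemArgs : ∀ i → Elem k (args i)
  elemArgs fz     = eF
  elemArgs (fs _) = eG

app₃ : ∀ {k φ} {F G H : Vector ℕ k → ℕ} → Elem₃ φ → Elem k F → Elem k G → Elem k H →
       Elem k (λ x → φ (F x) (G x) (H x))
app₃ {k} {F = F} {G} {H} (elem₃ e) eF eG eH = e-comp {G = args} e elemArgs
  where
  args : Fin 3 → Vector ℕ k → ℕ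
  args fz           = F
  args (fs fz)      = G
  args (fs (fs _))  = H
  elemArgs : ∀ i → Elem k (args i)
  elemArgs fz          = eF
  elemArgs (fs fz)     = eG
  elemArgs (fs (fs _)) = eH

π₀ : ∀ {k} → Elem (suc k) (λ x → x fz)
π₀ = e-proj fz

π₁ : ∀ {k} → Elem (2 + k) (λ x → x (fs fz))
π₁ = e-proj (fs fz)

π₂ : ∀ {k} → Elem (3 + k) (λ x → x (fs (fs fz)))
π₂ = e-proj (fs (fs fz))

π₃ : ∀ {k} → Elem (4 + k) (λ x → x (fs (fs (fs fz))))
π₃ = e-proj (fs (fs (fs fz)))

suc-elem : Elem₁ suc
suc-elem = elem₁ e-suc

2^-elem : Elem₁ (2 ^_)
2^-elem = elem₁ e-exp

const-elem : ∀ {k} n → Elem k (λ _ → n)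
const-elem {k} n = e-comp {G = λ ()} (closed n) (λ ())
  where
  closed : ∀ n → Elem 0 (λ _ → n)
  closed zero    = e-zero
  closed (suc n) = app₁ suc-elem (closed n)

bounded-rec : ∀ {k} (φ : ℕ → Vector ℕ k → ℕ) {G : Vector ℕ k → ℕ} {H : Vector ℕ (2 + k) → ℕ}
              {J : Vector ℕ (suc k) → ℕ} → Elem k G → Elem (2 + k) H → Elem (suc k) J →
              (∀ x → φ 0 x ≡ G x) → (∀ y x → φ (suc y) x ≡ H (y ∷ φ y x ∷ x)) →
              (∀ v → φ (v fz) (tail v) ≤ J v) →
              Elem (suc k) (λ v → φ (v fz) (tail v))
bounded-rec φ = e-brec (λ v → φ (v fz) (tail v))

n<2^n : ∀ n → n < 2 ^ n
n<2^n zero    = s≤s z≤n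
n<2^n (suc n) = begin-strict
  suc n         <⟨ s≤s (n<2^n n) ⟩
  1 + 2 ^ n     ≤⟨ +-monoˡ-≤ (2 ^ n) (m^n>0 2 n) ⟩
  2 ^ n + 2 ^ n ≡⟨ cong (2 ^ n +_) (sym (+-identityʳ (2 ^ n))) ⟩
  2 ^ suc n     ∎
  where open ≤-Reasoning

⊔-elem : Elem₂ _⊔_
⊔-elem = elem₂ e-max

+-elem : Elem₂ _+_
+-elem = elem₂ (bounded-rec (λ y x → y + x fz) π₀ (app₁ suc-elem π₁)
  (app₁ 2^-elem (app₁ suc-elem (app₂ ⊔-elem π₀ π₁)))
  (λ _ → refl) (λ _ _ → refl) (λ v → bound (v fz) (v (fs fz))))
  where
  bound : ∀ y x → y + x ≤ 2 ^ suc (y ⊔ x)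
  bound y x = begin
    y + x             ≤⟨ +-mono-≤ (m≤m⊔n y x) (m≤n⊔m y x) ⟩
    (y ⊔ x) + (y ⊔ x) ≤⟨ +-mono-≤ (<⇒≤ (n<2^n (y ⊔ x))) (≤-trans (<⇒≤ (n<2^n (y ⊔ x))) (m≤m+n _ 0)) ⟩
    2 ^ suc (y ⊔ x)   ∎
    where open ≤-Reasoning

*-elem : Elem₂ _*_
*-elem = elem₂ (bounded-rec (λ y x → y * x fz) (const-elem 0) (app₂ +-elem π₂ π₁)
  (app₁ 2^-elem (app₂ +-elem π₀ π₁)) (λ _ → refl) (λ _ _ → refl) (λ v → bound (v fz) (v (fs fz))))
  where
  bound : ∀ y x → y * x ≤ 2 ^ (y + x)
  bound y x rewrite ^-distribˡ-+-* 2 y x = *-mono-≤ (<⇒≤ (n<2^n y)) (<⇒≤ (n<2^n x))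

^-elem : Elem₂ _^_
^-elem = elem₂ (app₂ flipped π₁ π₀)
  where
  bound : ∀ y x → x ^ y ≤ 2 ^ (x * y)
  bound y x rewrite sym (^-*-assoc 2 x y) = ^-monoˡ-≤ y (<⇒≤ (n<2^n x))
  flipped : Elem₂ (λ y x → x ^ y)
  flipped = elem₂ (bounded-rec (λ y x → x fz ^ y) (const-elem 1) (app₂ *-elem π₂ π₁)
    (app₁ 2^-elem (app₂ *-elem π₁ π₀)) (λ _ → refl) (λ _ _ → refl) (λ v → bound (v fz) (v (fs fz))))

pred-elem : Elem₁ pred
pred-elem = elem₁ (bounded-rec (λ y _ → pred y) (const-elem 0) π₀ π₀
  (λ _ → refl) (λ _ _ → refl) (λ v → pred[n]≤n {v fz}))

∸-elem : Elem₂ _∸_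
∸-elem = elem₂ (app₂ flipped π₁ π₀)
  where
  flipped : Elem₂ (λ y x → x ∸ y)
  flipped = elem₂ (bounded-rec (λ y x → x fz ∸ y) π₀ (app₁ pred-elem π₁) π₁
    (λ _ → refl) (λ y x → sym (pred[m∸n]≡m∸[1+n] (x fz) y)) (λ v → m∸n≤m (v (fs fz)) (v fz)))

⊓-elem : Elem₂ _⊓_
⊓-elem = elem₂ (e-ext (app₂ ∸-elem π₀ (app₂ ∸-elem π₀ π₁)) (λ x → m∸[m∸n]≡m⊓n (x fz) (x (fs fz))))
  where
  m∸[m∸n]≡m⊓n : ∀ m n → m ∸ (m ∸ n) ≡ m ⊓ n
  m∸[m∸n]≡m⊓n zero    zero    = refl
  m∸[m∸n]≡m⊓n zero    (suc n) = refl
  m∸[m∸n]≡m⊓n (suc m) zero    = n∸n≡0 (suc m)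
  m∸[m∸n]≡m⊓n (suc m) (suc n) = trans (+-∸-assoc 1 (m∸n≤m m n)) (cong suc (m∸[m∸n]≡m⊓n m n))

ifz : ℕ → ℕ → ℕ → ℕ
ifz zero    a _ = a
ifz (suc _) _ b = b

ifz-elem : Elem₃ ifz
ifz-elem = elem₃ (bounded-rec (λ c x → ifz c (x fz) (x (fs fz))) π₀ π₃ (app₂ +-elem π₁ π₂)
  (λ _ → refl) (λ _ _ → refl) (λ v → bound (v fz) (v (fs fz)) (v (fs (fs fz)))))
  where
  bound : ∀ c a b → ifz c a b ≤ a + b
  bound zero    a b = m≤m+n a b
  bound (suc _) a b = m≤n+m b a

-- Bounded minimisation: the least y < z with p y ≢ 0, and z if there is none.

mu : ℕ → (ℕ → ℕ) → ℕ
mu zero    p = 0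
mu (suc z) p = ifz (z ∸ mu z p) (ifz (p z) (suc z) z) (mu z p)

mu≤ : ∀ z p → mu z p ≤ z
mu≤ zero    p = z≤n
mu≤ (suc z) p with z ∸ mu z p
... | suc _ = m≤n⇒m≤1+n (mu≤ z p)
... | zero with p z
...   | zero  = ≤-refl
...   | suc _ = n≤1+n z

mu-least : ∀ z p y → y < mu z p → p y ≡ 0
mu-least zero    p y ()
mu-least (suc z) p y y<mu with z ∸ mu z p in eq
... | suc _ = mu-least z p y y<mu
... | zero with p z in pz
...   | suc _ = mu-least z p y (subst (y <_) (sym mu≡z) y<mu)
  where mu≡z = ≤-antisym (mu≤ z p) (m∸n≡0⇒m≤n eq)
...   | zero with y ≟ z
...     | yes refl = pz
...     | no y≢z   = mu-least z p y (subst (y <_) (sym mu≡z) (≤∧≢⇒< (≤-pred y<mu) y≢z))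
  where mu≡z = ≤-antisym (mu≤ z p) (m∸n≡0⇒m≤n eq)

mu-found : ∀ z p → mu z p < z → p (mu z p) ≢ 0
mu-found zero    p ()
mu-found (suc z) p mu<z with z ∸ mu z p in eq
... | suc _ = mu-found z p (m∸n≢0⇒n<m (λ e → 0≢1+n (trans (sym e) eq)))
... | zero with p z in pz
...   | zero  = λ _ → <-irrefl refl mu<z
...   | suc _ = λ pz≡0 → 0≢1+n (trans (sym pz≡0) pz)

mu≤witness : ∀ z p y → y < z → p y ≢ 0 → mu z p ≤ y
mu≤witness z p y y<z py≢0 with mu z p ≤? y
... | yes mu≤y = mu≤y
... | no  mu≰y = ⊥-elim (py≢0 (mu-least z p y (≰⇒> mu≰y)))

mu-unique : ∀ z p y → y < z → p y ≢ 0 → (∀ w → w < y → p w ≡ 0) → mu z p ≡ y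
mu-unique z p y y<z py≢0 below with <-cmp (mu z p) y
... | tri< mu<y _ _ = ⊥-elim (mu-found z p (<-trans mu<y y<z) (below _ mu<y))
... | tri≈ _ mu≡y _ = mu≡y
... | tri> _ _ y<mu = ⊥-elim (py≢0 (mu-least z p y y<mu))

mu-none : ∀ z p → (∀ w → w < z → p w ≡ 0) → mu z p ≡ z
mu-none z p none with m≤n⇒m<n∨m≡n (mu≤ z p)
... | inj₁ mu<z = ⊥-elim (mu-found z p mu<z (none _ mu<z))
... | inj₂ mu≡z = mu≡z

mu-elem : ∀ {k} {χ : ℕ → Vector ℕ k → ℕ} → Elem (suc k) (λ v → χ (v fz) (tail v)) →
          Elem (suc k) (λ v → mu (v fz) (λ y → χ y (tail v)))
mu-elem {k} {χ} e = bounded-rec (λ z x → mu z (λ y → χ y x)) (const-elem 0)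
  (app₃ ifz-elem (app₂ ∸-elem π₀ π₁) (app₃ ifz-elem (e-comp e skip₁) (app₁ suc-elem π₀) π₀) π₁) π₀
  (λ _ → refl) (λ _ _ → refl) (λ v → mu≤ (v fz) _)
  where
  skip₁ : ∀ i → Elem (2 + k) (λ v → (v fz ∷ tail (tail v)) i)
  skip₁ fz     = e-proj fz
  skip₁ (fs i) = e-proj (fs (fs i))

-- quot m n = m / n for n ≢ 0, as the least q with m < (q+1) n.
quot : ℕ → ℕ → ℕ
quot m n = mu (suc m) (λ q → suc q * n ∸ m)

quot-elem : Elem₂ quot
quot-elem = elem₂ (app₃ search (app₁ suc-elem π₀) π₀ π₁)
  where
  search : Elem₃ (λ z m n → mu z (λ y → suc y * n ∸ m))
  search = elem₃ (mu-elem {χ = λ q x → suc q * x (fs fz) ∸ x fz}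
                          (app₂ ∸-elem (app₂ *-elem (app₁ suc-elem π₀) π₂) π₁))

quot≡/ : ∀ m n .{{_ : NonZero n}} → quot m n ≡ m / n
quot≡/ m n = mu-unique (suc m) (λ q → suc q * n ∸ m) (m / n) (s≤s (m/n≤m m n))
  (λ eq → <-irrefl refl (≤-trans m<[1+m/n]n (m∸n≡0⇒m≤n eq)))
  (λ w w<m/n → m≤n⇒m∸n≡0 (≤-trans (*-monoˡ-≤ n w<m/n) (m/n*n≤m m n)))
  where
  m<[1+m/n]n : m < suc (m / n) * n
  m<[1+m/n]n = begin-strict
    m                 ≡⟨ m≡m%n+[m/n]*n m n ⟩
    m % n + m / n * n <⟨ +-monoˡ-< (m / n * n) (m%n<n m n) ⟩
    n + m / n * n     ∎
    where open ≤-Reasoning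

-- Primes

∣χ : ℕ → ℕ → ℕ
∣χ d n = ifz (n ∸ quot n d * d) 1 0

∣χ-elem : Elem₂ ∣χ
∣χ-elem = elem₂ (app₃ ifz-elem (app₂ ∸-elem π₁ (app₂ *-elem (app₂ quot-elem π₁ π₀) π₀))
                             (const-elem 1) (const-elem 0))

∣χ≡ifz% : ∀ d n → ∣χ (suc d) n ≡ ifz (n % suc d) 1 0
∣χ≡ifz% d n = trans (cong (λ q → ifz (n ∸ q * suc d) 1 0) (quot≡/ n (suc d)))
                     (cong (λ r → ifz r 1 0) (sym (m%n≡m∸m/n*n n (suc d))))

∣⇒∣χ≡1 : ∀ {d n} → suc d ∣ n → ∣χ (suc d) n ≡ 1
∣⇒∣χ≡1 {d} {n} d∣n rewrite ∣χ≡ifz% d n | n∣m⇒m%n≡0 n (suc d) d∣n = refl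

∤⇒∣χ≡0 : ∀ {d n} → ¬ suc d ∣ n → ∣χ (suc d) n ≡ 0
∤⇒∣χ≡0 {d} {n} d∤n rewrite ∣χ≡ifz% d n with n % suc d in eq
... | zero  = ⊥-elim (d∤n (m%n≡0⇒n∣m n (suc d) eq))
... | suc _ = refl

nontrivialDivisorχ : ℕ → ℕ → ℕ
nontrivialDivisorχ d n = ifz (d ∸ 1) 0 (∣χ d n)

nontrivialDivisorχ-elem : Elem₂ nontrivialDivisorχ
nontrivialDivisorχ-elem = elem₂ (app₃ ifz-elem (app₂ ∸-elem π₀ (const-elem 1)) (const-elem 0) (un₂ ∣χ-elem))

nontrivialDivisorχ≢0 : ∀ {d n} → 2 ≤ d → d ∣ n → nontrivialDivisorχ d n ≢ 0
nontrivialDivisorχ≢0 {suc zero}    (s≤s ())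
nontrivialDivisorχ≢0 {suc (suc d)} {n} _ d∣n rewrite ∣⇒∣χ≡1 {suc d} d∣n = λ ()

nontrivialDivisorχ≢0⇒ : ∀ d n → nontrivialDivisorχ d n ≢ 0 → 2 ≤ d × d ∣ n
nontrivialDivisorχ≢0⇒ zero          n χ≢0 = ⊥-elim (χ≢0 refl)
nontrivialDivisorχ≢0⇒ (suc zero)    n χ≢0 = ⊥-elim (χ≢0 refl)
nontrivialDivisorχ≢0⇒ (suc (suc d)) n χ≢0 with suc (suc d) ∣? n
... | yes d∣n = s≤s (s≤s z≤n) , d∣n
... | no  d∤n = ⊥-elim (χ≢0 (∤⇒∣χ≡0 d∤n))

minDivisor : ℕ → ℕ
minDivisor n = mu n (λ d → nontrivialDivisorχ d n)

minDivisor-elem : Elem₁ minDivisor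
minDivisor-elem = elem₁ (app₂ search π₀ π₀)
  where
  search : Elem₂ (λ z n → mu z (λ d → nontrivialDivisorχ d n))
  search = elem₂ (mu-elem {χ = λ d x → nontrivialDivisorχ d (x fz)} (un₂ nontrivialDivisorχ-elem))

minDivisor≤ : ∀ n → minDivisor n ≤ n
minDivisor≤ n = mu≤ n _

minDivisor<⇒ : ∀ {n} → minDivisor n < n → 2 ≤ minDivisor n × minDivisor n ∣ n
minDivisor<⇒ {n} lt = nontrivialDivisorχ≢0⇒ (minDivisor n) n (mu-found n _ lt)

minDivisor∣ : ∀ n → minDivisor n ∣ n
minDivisor∣ n with m≤n⇒m<n∨m≡n (minDivisor≤ n)
... | inj₁ lt = proj₂ (minDivisor<⇒ lt)
... | inj₂ eq = subst (_∣ n) (sym eq) ∣-refl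

minDivisor≥2 : ∀ {n} → 2 ≤ n → 2 ≤ minDivisor n
minDivisor≥2 {n} 2≤n with m≤n⇒m<n∨m≡n (minDivisor≤ n)
... | inj₁ lt = proj₁ (minDivisor<⇒ lt)
... | inj₂ eq = subst (2 ≤_) (sym eq) 2≤n

minDivisor-rough : ∀ n → minDivisor n Rough n
minDivisor-rough n (hasNonTrivialDivisor {d} d<md d∣n) =
  nontrivialDivisorχ≢0 (nonTrivial⇒n>1 d) d∣n (mu-least n _ d d<md)

minDivisor-prime : ∀ {n} → 2 ≤ n → Prime (minDivisor n)
minDivisor-prime {n} 2≤n = rough∧∣⇒prime {{n>1⇒nonTrivial (minDivisor≥2 2≤n)}}
  (minDivisor-rough n) (minDivisor∣ n)

prime⇒minDivisor≡ : ∀ {n} → Prime n → minDivisor n ≡ n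
prime⇒minDivisor≡ {n} pn with m≤n⇒m<n∨m≡n (minDivisor≤ n)
... | inj₂ eq = eq
... | inj₁ lt = ⊥-elim (Prime.notComposite pn
  (hasNonTrivialDivisor {{n>1⇒nonTrivial (proj₁ (minDivisor<⇒ lt))}} lt (minDivisor∣ n)))

prime⇒≥2 : ∀ {p} → Prime p → 2 ≤ p
prime⇒≥2 {p} pp = nonTrivial⇒n>1 p {{prime⇒nonTrivial pp}}

primeχ : ℕ → ℕ
primeχ n = ifz (n ∸ 1) 0 (ifz (n ∸ minDivisor n) 1 0)

primeχ-elem : Elem₁ primeχ
primeχ-elem = elem₁ (app₃ ifz-elem (app₂ ∸-elem π₀ (const-elem 1)) (const-elem 0)
  (app₃ ifz-elem (app₂ ∸-elem π₀ (app₁ minDivisor-elem π₀)) (const-elem 1) (const-elem 0)))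

prime⇒primeχ≢0 : ∀ {n} → Prime n → primeχ n ≢ 0
prime⇒primeχ≢0 {n} pn with prime⇒≥2 pn
prime⇒primeχ≢0 {suc (suc n)} pn | _ rewrite prime⇒minDivisor≡ pn | n∸n≡0 n = λ ()

primeχ≢0⇒prime : ∀ n → primeχ n ≢ 0 → Prime n
primeχ≢0⇒prime zero          χ≢0 = ⊥-elim (χ≢0 refl)
primeχ≢0⇒prime (suc zero)    χ≢0 = ⊥-elim (χ≢0 refl)
primeχ≢0⇒prime (suc (suc n)) χ≢0 with suc (suc n) ∸ minDivisor (suc (suc n)) in eq
... | zero  = subst Prime (≤-antisym (minDivisor≤ _) (m∸n≡0⇒m≤n eq)) (minDivisor-prime {suc (suc n)} (s≤s (s≤s z≤n)))
... | suc _ = ⊥-elim (χ≢0 refl)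

¬prime⇒primeχ≡0 : ∀ {n} → ¬ Prime n → primeχ n ≡ 0
¬prime⇒primeχ≡0 {n} ¬pn with primeχ n in eq
... | zero  = refl
... | suc _ = ⊥-elim (¬pn (primeχ≢0⇒prime n (λ χ≡0 → 0≢1+n (trans (sym χ≡0) eq))))

LeastPrimeFrom : ℕ → ℕ → Set
LeastPrimeFrom s r = Prime r × s ≤ r × (∀ q → s ≤ q → q < r → ¬ Prime q)

searchPrime-least : ∀ k s t → t ≤ k → Prime (s + t) → LeastPrimeFrom s (searchPrime k s)
searchPrime-least zero s .zero z≤n p[s+0] =
  subst Prime (+-identityʳ s) p[s+0] , ≤-refl , λ q s≤q q<s _ → <-irrefl refl (≤-trans q<s s≤q)
searchPrime-least (suc k) s t t≤1+k p[s+t] with prime? s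
... | yes ps = ps , ≤-refl , λ q s≤q q<s _ → <-irrefl refl (≤-trans q<s s≤q)
... | no ¬ps with t
...   | zero   = ⊥-elim (¬ps (subst Prime (+-identityʳ s) p[s+t]))
...   | suc t′ with searchPrime-least k (suc s) t′ (≤-pred t≤1+k) (subst Prime (+-suc s t′) p[s+t])
...     | (pr , 1+s≤r , least) = pr , ≤-trans (n≤1+n s) 1+s≤r , least′
  where
  least′ : ∀ q → s ≤ q → q < searchPrime k (suc s) → ¬ Prime q
  least′ q s≤q q<r with m≤n⇒m<n∨m≡n s≤q
  ... | inj₁ s<q  = least q s<q q<r
  ... | inj₂ refl = ¬ps

-- Euclid: a prime factor of p ! + 1 exceeds p.
prime-above : ∀ p → Σ[ q ∈ ℕ ] (Prime q × p < q × q ≤ p ! + 1)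
prime-above p = minDivisor M , minDivisor-prime 2≤M , p<q , ∣⇒≤ {{>-nonZero (≤-trans (s≤s z≤n) 2≤M)}} (minDivisor∣ M)
  where
  M = p ! + 1
  2≤M : 2 ≤ M
  2≤M = subst (2 ≤_) (+-comm 1 (p !)) (s≤s (1≤n! p))
  q = minDivisor M
  q≥2 = minDivisor≥2 2≤M
  p<q : p < q
  p<q with p <? q
  ... | yes lt = lt
  ... | no  nlt = ⊥-elim (<-irrefl refl (≤-trans q≥2 (≤-reflexive (∣1⇒≡1 q∣1))))
    where
    q∣p! : q ∣ p !
    q∣p! with q | q≥2
    ... | suc q′ | _ = ∣-trans (m∣m*n (q′ !)) (m≤n⇒m!∣n! (≮⇒≥ nlt))
    q∣1 : q ∣ 1
    q∣1 = ∣m+n∣m⇒∣n (minDivisor∣ M) q∣p!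

nextPrime-least : ∀ p → LeastPrimeFrom (suc p) (nextPrime p)
nextPrime-least p with prime-above p
... | q , pq , p<q , q≤M = searchPrime-least (p ! + 1) (suc p) (q ∸ suc p)
  (≤-trans (m∸n≤m q (suc p)) q≤M) (subst Prime (sym (m+[n∸m]≡n p<q)) pq)

nextPrime⊓ : ℕ → ℕ → ℕ
nextPrime⊓ p c = mu c (λ y → primeχ y * (y ∸ p))

nextPrime⊓-elem : Elem₂ nextPrime⊓
nextPrime⊓-elem = elem₂ (app₂ search π₁ π₀)
  where
  search : Elem₂ (λ c p → mu c (λ y → primeχ y * (y ∸ p)))
  search = elem₂ (mu-elem {χ = λ y x → primeχ y * (y ∸ x fz)}
                          (app₂ *-elem (app₁ primeχ-elem π₀) (app₂ ∸-elem π₀ π₁)))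

primeAbove-χ≡0 : ∀ {p w} → (p < w → ¬ Prime w) → primeχ w * (w ∸ p) ≡ 0
primeAbove-χ≡0 {p} {w} notPrime with w ≤? p
... | yes w≤p = trans (cong (primeχ w *_) (m≤n⇒m∸n≡0 w≤p)) (*-zeroʳ (primeχ w))
... | no  w≰p = cong (_* (w ∸ p)) (¬prime⇒primeχ≡0 (notPrime (≰⇒> w≰p)))

nextPrime⊓≡ : ∀ p c → nextPrime⊓ p c ≡ nextPrime p ⊓ c
nextPrime⊓≡ p c with nextPrime-least p | nextPrime p <? c
... | (pq , p<q , least) | yes q<c = trans
  (mu-unique c _ (nextPrime p) q<c found below) (sym (m≤n⇒m⊓n≡m (<⇒≤ q<c)))
  where
  found : primeχ (nextPrime p) * (nextPrime p ∸ p) ≢ 0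
  found χ≡0 with m*n≡0⇒m≡0∨n≡0 (primeχ (nextPrime p)) χ≡0
  ... | inj₁ e = prime⇒primeχ≢0 pq e
  ... | inj₂ e = <-irrefl refl (≤-trans p<q (m∸n≡0⇒m≤n e))
  below : ∀ w → w < nextPrime p → primeχ w * (w ∸ p) ≡ 0
  below w w<q = primeAbove-χ≡0 (λ p<w → least w p<w w<q)
... | (pq , p<q , least) | no q≮c = trans
  (mu-none c _ none) (sym (m≥n⇒m⊓n≡n (≮⇒≥ q≮c)))
  where
  none : ∀ w → w < c → primeχ w * (w ∸ p) ≡ 0
  none w w<c = primeAbove-χ≡0 (λ p<w → least w p<w (<-≤-trans w<c (≮⇒≥ q≮c)))

P-prime : ∀ i → Prime (P i)
P-prime zero    = prime[2]
P-prime (suc i) = proj₁ (nextPrime-least (P i))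

P<P[1+i] : ∀ i → P i < P (suc i)
P<P[1+i] i = proj₁ (proj₂ (nextPrime-least (P i)))

P≥i+2 : ∀ i → i + 2 ≤ P i
P≥i+2 zero    = ≤-refl
P≥i+2 (suc i) = ≤-trans (s≤s (P≥i+2 i)) (P<P[1+i] i)

P≥2 : ∀ i → 2 ≤ P i
P≥2 i = ≤-trans (m≤n+m 2 i) (P≥i+2 i)

P-mono-< : ∀ {i j} → i < j → P i < P j
P-mono-< {i} {suc j} (s≤s i≤j) with m≤n⇒m<n∨m≡n i≤j
... | inj₁ i<j  = <-trans (P-mono-< i<j) (P<P[1+i] j)
... | inj₂ refl = P<P[1+i] i

P-injective : ∀ {i j} → P i ≡ P j → i ≡ j
P-injective {i} {j} eq with <-cmp i j
... | tri< i<j _ _ = ⊥-elim (<-irrefl eq (P-mono-< i<j))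
... | tri≈ _ i≡j _ = i≡j
... | tri> _ _ j<i = ⊥-elim (<-irrefl (sym eq) (P-mono-< j<i))

-- Capped versions x ⊓ c are elementary in the cap c, which also serves as the bound.

P⊓ : ℕ → ℕ → ℕ
P⊓ zero    c = 2 ⊓ c
P⊓ (suc i) c = nextPrime⊓ (P⊓ i c) c

P⊓≡ : ∀ i c → P⊓ i c ≡ P i ⊓ c
P⊓≡ zero    c = refl
P⊓≡ (suc i) c rewrite P⊓≡ i c with P i <? c
... | yes Pi<c rewrite m≤n⇒m⊓n≡m (<⇒≤ Pi<c) = nextPrime⊓≡ (P i) c
... | no  Pi≮c rewrite m≥n⇒m⊓n≡n (≮⇒≥ Pi≮c) = trans (nextPrime⊓≡ c c)
  (trans (m≥n⇒m⊓n≡n (<⇒≤ (proj₁ (proj₂ (nextPrime-least c)))))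
         (sym (m≥n⇒m⊓n≡n (≤-trans (≮⇒≥ Pi≮c) (<⇒≤ (P<P[1+i] i))))))

P⊓-elem : Elem₂ P⊓
P⊓-elem = elem₂ (bounded-rec (λ i x → P⊓ i (x fz)) (app₂ ⊓-elem (const-elem 2) π₀)
  (app₂ nextPrime⊓-elem π₁ π₂) π₁ (λ _ → refl) (λ _ _ → refl)
  (λ v → subst (_≤ v (fs fz)) (sym (P⊓≡ (v fz) (v (fs fz)))) (m⊓n≤n _ _)))

prime∤1 : ∀ {p} → Prime p → ¬ p ∣ 1
prime∤1 pp p∣1 = <-irrefl (sym (∣1⇒≡1 p∣1)) (prime⇒≥2 pp)

prime∣^⇒∣ : ∀ {p} m n → Prime p → p ∣ m ^ n → p ∣ m
prime∣^⇒∣ m zero    pp p∣1 = ⊥-elim (prime∤1 pp p∣1)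
prime∣^⇒∣ m (suc n) pp p∣m*m^n with euclidsLemma m (m ^ n) pp p∣m*m^n
... | inj₁ p∣m   = p∣m
... | inj₂ p∣m^n = prime∣^⇒∣ m n pp p∣m^n

m≤m^n : ∀ {m n} → 1 ≤ m → 1 ≤ n → m ≤ m ^ n
m≤m^n {m} {suc n} 1≤m _ = begin
  m         ≡⟨ sym (*-identityʳ m) ⟩
  m * 1     ≤⟨ *-monoʳ-≤ m (m^n>0 m {{>-nonZero 1≤m}} n) ⟩
  m * m ^ n ∎
  where open ≤-Reasoning

n<m^n : ∀ m n → 2 ≤ m → n < m ^ n
n<m^n m n 2≤m = ≤-trans (n<2^n n) (^-monoˡ-≤ n 2≤m)

gExp : ℕ → ℕ → ℕ
gExp j x = 2 * (j + 2) * (x + 1) ^ 3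

gExp-elem : Elem₂ gExp
gExp-elem = elem₂ (app₂ *-elem (app₂ *-elem (const-elem 2) (app₂ +-elem π₀ (const-elem 2)))
                               (app₂ ^-elem (app₂ +-elem π₁ (const-elem 1)) (const-elem 3)))

4[x+1]≤gExp : ∀ j x → 4 * (x + 1) ≤ gExp j x
4[x+1]≤gExp j x = *-mono-≤ (*-monoʳ-≤ 2 (m≤n+m 2 j)) (m≤m^n {n = 3} (m≤n+m 1 x) (s≤s z≤n))

x<gExp : ∀ j x → x < gExp j x
x<gExp j x = ≤-trans (≤-trans (m≤n+m (suc x) _) (≤-reflexive (solve-∀′ x))) (4[x+1]≤gExp j x)
  where
  solve-∀′ : ∀ x → 3 * (x + 1) + suc x ≡ 4 * (x + 1)
  solve-∀′ = solve-∀

gExp<g[1+j] : ∀ j → gExp j (g j) < g (suc j)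
gExp<g[1+j] j = n<m^n (P j) (gExp j (g j)) (P≥2 j)

3g≤g[1+j] : ∀ j → 3 * g j ≤ g (suc j)
3g≤g[1+j] j = begin
  3 * g j           ≤⟨ *-mono-≤ (n≤1+n 3) (m≤m+n (g j) 1) ⟩
  4 * (g j + 1)     ≤⟨ 4[x+1]≤gExp j (g j) ⟩
  gExp j (g j)      ≤⟨ <⇒≤ (gExp<g[1+j] j) ⟩
  g (suc j)         ∎
  where open ≤-Reasoning

j<g : ∀ j → j < g j
j<g zero    = s≤s z≤n
j<g (suc j) = ≤-trans (s≤s (j<g j)) (≤-trans (x<gExp j (g j)) (<⇒≤ (gExp<g[1+j] j)))

g-mono : ∀ {i j} → i ≤ j → g i ≤ g j
g-mono {i} {j} i≤j with m≤n⇒m<n∨m≡n i≤j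
... | inj₂ refl = ≤-refl
g-mono {i} {suc j} _ | inj₁ (s≤s i≤j) = ≤-trans (g-mono i≤j) (≤-trans (m≤n*m (g j) 3) (3g≤g[1+j] j))

pow⊓ : ℕ → ℕ → ℕ → ℕ
pow⊓ x y c = (x ^ y) ⊓ c

pow⊓-elem : Elem₃ pow⊓
pow⊓-elem = elem₃ (app₂ ⊓-elem (app₂ ^-elem π₀ π₁) π₂)

pow⊓-capped : ∀ a e c → 2 ≤ a → 1 ≤ e → 2 ≤ c → pow⊓ (a ⊓ c) (e ⊓ c) c ≡ (a ^ e) ⊓ c
pow⊓-capped a e c 2≤a 1≤e 2≤c with a ≤? c | e ≤? c
... | yes a≤c | yes e≤c rewrite m≤n⇒m⊓n≡m a≤c | m≤n⇒m⊓n≡m e≤c = refl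
... | yes a≤c | no  e≰c rewrite m≤n⇒m⊓n≡m a≤c | m≥n⇒m⊓n≡n (≰⇒≥ e≰c) =
  trans (m≥n⇒m⊓n≡n (<⇒≤ (n<m^n a c 2≤a)))
        (sym (m≥n⇒m⊓n≡n (≤-trans (<⇒≤ (≰⇒> e≰c)) (<⇒≤ (n<m^n a e 2≤a)))))
... | no  a≰c | yes e≤c rewrite m≥n⇒m⊓n≡n (≰⇒≥ a≰c) | m≤n⇒m⊓n≡m e≤c =
  trans (m≥n⇒m⊓n≡n (m≤m^n (≤-trans (s≤s z≤n) 2≤c) 1≤e))
        (sym (m≥n⇒m⊓n≡n (≤-trans (<⇒≤ (≰⇒> a≰c)) (m≤m^n (≤-trans (s≤s z≤n) 2≤a) 1≤e))))
... | no  a≰c | no  e≰c rewrite m≥n⇒m⊓n≡n (≰⇒≥ a≰c) | m≥n⇒m⊓n≡n (≰⇒≥ e≰c) =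
  trans (m≥n⇒m⊓n≡n (m≤m^n (≤-trans (s≤s z≤n) 2≤c) (≤-trans (s≤s z≤n) 2≤c)))
        (sym (m≥n⇒m⊓n≡n (≤-trans (<⇒≤ (≰⇒> a≰c)) (m≤m^n (≤-trans (s≤s z≤n) 2≤a) 1≤e))))

gExp-capped : ∀ j x c → gExp j (x ⊓ c) ⊓ c ≡ gExp j x ⊓ c
gExp-capped j x c with x ≤? c
... | yes x≤c rewrite m≤n⇒m⊓n≡m x≤c = refl
... | no  x≰c rewrite m≥n⇒m⊓n≡n (≰⇒≥ x≰c) =
  trans (m≥n⇒m⊓n≡n (<⇒≤ (x<gExp j c))) (sym (m≥n⇒m⊓n≡n (≤-trans (≰⇒≥ x≰c) (<⇒≤ (x<gExp j x)))))

g⊓ : ℕ → ℕ → ℕ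
g⊓ zero    c = 1 ⊓ c
g⊓ (suc j) c = pow⊓ (P⊓ j c) (gExp j (g⊓ j c) ⊓ c) c

g⊓≡ : ∀ j c → 2 ≤ c → g⊓ j c ≡ g j ⊓ c
g⊓≡ zero    c _   = refl
g⊓≡ (suc j) c 2≤c rewrite P⊓≡ j c | g⊓≡ j c 2≤c | gExp-capped j (g j) c =
  pow⊓-capped (P j) (gExp j (g j)) c (P≥2 j) (≤-trans (s≤s z≤n) (x<gExp j (g j))) 2≤c

g⊓≤ : ∀ j c → g⊓ j c ≤ c
g⊓≤ zero    c = m⊓n≤n 1 c
g⊓≤ (suc j) c = m⊓n≤n _ c

g⊓-elem : Elem₂ g⊓
g⊓-elem = elem₂ (bounded-rec (λ j x → g⊓ j (x fz)) (app₂ ⊓-elem (const-elem 1) π₀)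
  (app₃ pow⊓-elem (app₂ P⊓-elem π₀ π₂) (app₂ ⊓-elem (app₂ gExp-elem π₀ π₁) π₂) π₂) π₁
  (λ _ → refl) (λ _ _ → refl) (λ v → g⊓≤ (v fz) (v (fs fz))))

*-capped : ∀ x y c → 1 ≤ x → 1 ≤ y → 2 ≤ c → ((x ⊓ c) * (y ⊓ c)) ⊓ c ≡ (x * y) ⊓ c
*-capped x y c 1≤x 1≤y 2≤c with x ≤? c | y ≤? c
... | yes x≤c | yes y≤c rewrite m≤n⇒m⊓n≡m x≤c | m≤n⇒m⊓n≡m y≤c = refl
... | no  x≰c | _ rewrite m≥n⇒m⊓n≡n (≰⇒≥ x≰c) =
  trans (m≥n⇒m⊓n≡n (m≤m*n c (y ⊓ c) {{>-nonZero (⊓-glb 1≤y (≤-trans (s≤s z≤n) 2≤c))}}))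
        (sym (m≥n⇒m⊓n≡n (≤-trans (<⇒≤ (≰⇒> x≰c)) (m≤m*n x y {{>-nonZero 1≤y}}))))
... | yes x≤c | no  y≰c rewrite m≤n⇒m⊓n≡m x≤c | m≥n⇒m⊓n≡n (≰⇒≥ y≰c) =
  trans (m≥n⇒m⊓n≡n (m≤n*m c x {{>-nonZero 1≤x}}))
        (sym (m≥n⇒m⊓n≡n (≤-trans (<⇒≤ (≰⇒> y≰c)) (m≤n*m y x {{>-nonZero 1≤x}}))))

-- Fractions of natural numbers

frac : (a q : ℕ) .{{_ : NonZero q}} → ℚ
frac a q = ℤ.+ a ℚ./ q

toℚᵘ-frac : ∀ a d → ℚ.toℚᵘ (frac a (suc d)) ℚᵘ.≃ ℚᵘ.mkℚᵘ (ℤ.+ a) d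
toℚᵘ-frac a d = ℚP.toℚᵘ-fromℚᵘ (ℚᵘ.mkℚᵘ (ℤ.+ a) d)

frac-mono-≤ : ∀ a q c r .{{_ : NonZero q}} .{{_ : NonZero r}} → a * r ≤ c * q → frac a q ℚ.≤ frac c r
frac-mono-≤ a (suc d) c (suc e) ar≤cq = ℚP.toℚᵘ-cancel-≤
  (ℚᵘP.≤-respʳ-≃ (ℚᵘP.≃-sym (toℚᵘ-frac c e)) (ℚᵘP.≤-respˡ-≃ (ℚᵘP.≃-sym (toℚᵘ-frac a d))
    (ℚᵘ.*≤* (subst₂ ℤ._≤_ (ℤP.pos-* a (suc e)) (ℤP.pos-* c (suc d)) (ℤ.+≤+ ar≤cq)))))

frac-cong : ∀ a q c r .{{_ : NonZero q}} .{{_ : NonZero r}} → a * r ≡ c * q → frac a q ≡ frac c r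
frac-cong a (suc d) c (suc e) ar≡cq = ℚP.toℚᵘ-injective
  (ℚᵘP.≃-trans (toℚᵘ-frac a d) (ℚᵘP.≃-trans
    (ℚᵘ.*≡* (trans (sym (ℤP.pos-* a (suc e))) (trans (cong ℤ.+_ ar≡cq) (ℤP.pos-* c (suc d)))))
    (ℚᵘP.≃-sym (toℚᵘ-frac c e))))

frac-+ : ∀ a q c r .{{_ : NonZero q}} .{{_ : NonZero r}} →
         frac a q ℚ.+ frac c r ≡ frac (a * r + c * q) (q * r) {{m*n≢0 q r}}
frac-+ a (suc d) c (suc e) = ℚP.toℚᵘ-injective
  (ℚᵘP.≃-trans (ℚP.toℚᵘ-homo-+ (frac a (suc d)) (frac c (suc e)))
  (ℚᵘP.≃-trans (ℚᵘP.+-cong (toℚᵘ-frac a d) (toℚᵘ-frac c e))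
  (ℚᵘP.≃-trans sum (ℚᵘP.≃-sym (toℚᵘ-frac _ _)))))
  where
  sum : ℚᵘ.mkℚᵘ (ℤ.+ a) d ℚᵘ.+ ℚᵘ.mkℚᵘ (ℤ.+ c) e ℚᵘ.≃ ℚᵘ.mkℚᵘ (ℤ.+ (a * suc e + c * suc d)) (e + d * suc e)
  sum = ℚᵘ.*≡* (cong (ℤ._* ℤ.+[1+ (e + d * suc e) ])
    (cong₂ ℤ._+_ (sym (ℤP.pos-* a (suc e))) (sym (ℤP.pos-* c (suc d)))))

frac-*-recip : ∀ D q .{{_ : NonZero q}} → frac D 1 ℚ.* recip q ≡ frac D q
frac-*-recip D (suc e) = ℚP.toℚᵘ-injective
  (ℚᵘP.≃-trans (ℚP.toℚᵘ-homo-* (frac D 1) (frac 1 (suc e)))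
  (ℚᵘP.≃-trans (ℚᵘP.*-cong (toℚᵘ-frac D 0) (toℚᵘ-frac 1 e))
  (ℚᵘP.≃-trans product (ℚᵘP.≃-sym (toℚᵘ-frac _ _)))))
  where
  product : ℚᵘ.mkℚᵘ (ℤ.+ D) 0 ℚᵘ.* ℚᵘ.mkℚᵘ (ℤ.+ 1) e ℚᵘ.≃ ℚᵘ.mkℚᵘ (ℤ.+ D) e
  product = ℚᵘ.*≡* (cong₂ ℤ._*_ (ℤP.*-identityʳ (ℤ.+ D)) (cong (λ x → ℤ.+ suc x) (sym (+-identityʳ e))))

recip≡frac : ∀ q .{{_ : NonZero q}} → recip q ≡ frac 1 q
recip≡frac (suc q) = refl

frac-zero : ∀ q .{{_ : NonZero q}} → frac 0 q ≡ 0ℚ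
frac-zero (suc d) = frac-cong 0 (suc d) 0 1 refl

recip-below : ∀ ε → 0ℚ ℚ.< ε → Σ[ d ∈ ℕ ] (frac 1 (suc d) ℚ.≤ ε)
recip-below (ℚ.mkℚ (ℤ.+ zero) d _) (ℚ.*<* (ℤ.+<+ ()))
recip-below (ℚ.mkℚ ℤ.-[1+ p ] d _) (ℚ.*<* ())
recip-below (ℚ.mkℚ (ℤ.+ suc p) d _) _ =
  d , ℚP.toℚᵘ-cancel-≤ (ℚᵘP.≤-respˡ-≃ (ℚᵘP.≃-sym (toℚᵘ-frac 1 d)) (ℚᵘ.*≤* 1*[1+d]≤[1+p]*[1+d]))
  where
  1*[1+d]≤[1+p]*[1+d] : ℤ.+ 1 ℤ.* ℤ.+ suc d ℤ.≤ ℤ.+ suc p ℤ.* ℤ.+ suc d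
  1*[1+d]≤[1+p]*[1+d] = subst₂ ℤ._≤_ (ℤP.pos-* 1 (suc d)) (ℤP.pos-* (suc p) (suc d))
    (ℤ.+≤+ (*-monoˡ-≤ (suc d) (s≤s {n = p} z≤n)))

commonDivisorχ : ℕ → ℕ → ℕ → ℕ
commonDivisorχ d a c = ∣χ d a * ∣χ d c

commonDivisorχ-elem : Elem₃ commonDivisorχ
commonDivisorχ-elem = elem₃ (app₂ *-elem (app₂ ∣χ-elem π₀ π₁) (app₂ ∣χ-elem π₀ π₂))

∣∧∣⇒commonDivisorχ≢0 : ∀ {d a c} → 1 ≤ d → d ∣ a → d ∣ c → commonDivisorχ d a c ≢ 0
∣∧∣⇒commonDivisorχ≢0 {suc d} _ d∣a d∣c rewrite ∣⇒∣χ≡1 d∣a | ∣⇒∣χ≡1 d∣c = λ ()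

commonDivisorχ≢0⇒∣∧∣ : ∀ {d a c} → 1 ≤ d → commonDivisorχ d a c ≢ 0 → d ∣ a × d ∣ c
commonDivisorχ≢0⇒∣∧∣ {suc d} {a} {c} _ χ≢0 with suc d ∣? a | suc d ∣? c
... | yes d∣a | yes d∣c = d∣a , d∣c
... | no  d∤a | _       = ⊥-elim (χ≢0 (cong (_* ∣χ (suc d) c) (∤⇒∣χ≡0 d∤a)))
... | yes _   | no  d∤c = ⊥-elim (χ≢0 (trans (cong (∣χ (suc d) a *_) (∤⇒∣χ≡0 d∤c)) (*-zeroʳ (∣χ (suc d) a))))

-- The largest y ≤ a dividing both a and c, found by searching downwards from a.
searchGcd : ℕ → ℕ → ℕ
searchGcd a c = a ∸ mu a (λ y → commonDivisorχ (a ∸ y) a c)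

searchGcd-elem : Elem₂ searchGcd
searchGcd-elem = elem₂ (app₂ ∸-elem π₀ (app₃ search π₀ π₀ π₁))
  where
  search : Elem₃ (λ z a c → mu z (λ y → commonDivisorχ (a ∸ y) a c))
  search = elem₃ (mu-elem {χ = λ y x → commonDivisorχ (x fz ∸ y) (x fz) (x (fs fz))}
                          (app₃ commonDivisorχ-elem (app₂ ∸-elem π₁ π₀) π₁ π₂))

module _ (a c : ℕ) where

  private
    μ = mu a (λ y → commonDivisorχ (a ∸ y) a c)

  common-divisor≤searchGcd : ∀ {e} → 1 ≤ e → e ≤ a → e ∣ a → e ∣ c → e ≤ searchGcd a c
  common-divisor≤searchGcd {e} 1≤e e≤a e∣a e∣c = subst (_≤ searchGcd a c) (m∸[m∸n]≡n e≤a)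
    (∸-monoʳ-≤ a (mu≤witness a _ (a ∸ e) (∸-monoʳ-< 1≤e e≤a)
      (subst (λ d → commonDivisorχ d a c ≢ 0) (sym (m∸[m∸n]≡n e≤a)) (∣∧∣⇒commonDivisorχ≢0 1≤e e∣a e∣c))))

  searchGcd-common-divisor : 1 ≤ a → searchGcd a c ∣ a × searchGcd a c ∣ c
  searchGcd-common-divisor 1≤a = commonDivisorχ≢0⇒∣∧∣ 1≤searchGcd (mu-found a _ μ<a)
    where
    1≤searchGcd : 1 ≤ searchGcd a c
    1≤searchGcd = common-divisor≤searchGcd ≤-refl 1≤a (1∣ a) (1∣ c)
    μ<a : μ < a
    μ<a = m∸n≢0⇒n<m (λ e → <-irrefl refl (subst (0 <_) e 1≤searchGcd))

searchGcd≡gcd : ∀ a c → 1 ≤ a → searchGcd a c ≡ gcd a c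
searchGcd≡gcd a c 1≤a = ≤-antisym
  (∣⇒≤ {{gcd≢0}} (gcd-greatest (proj₁ common) (proj₂ common)))
  (common-divisor≤searchGcd a c (n≢0⇒n>0 (≢-nonZero⁻¹ _ {{gcd≢0}})) (∣⇒≤ {{>-nonZero 1≤a}} (gcd[m,n]∣m a c))
                       (gcd[m,n]∣m a c) (gcd[m,n]∣n a c))
  where
  common = searchGcd-common-divisor a c 1≤a
  gcd≢0 : NonZero (gcd a c)
  gcd≢0 = ≢-nonZero (gcd[m,n]≢0 a c (inj₁ (λ a≡0 → <-irrefl (sym a≡0) 1≤a)))

cantor′ : ℕ → ℕ → ℕ
cantor′ a c = quot ((a + c) * (a + c + 1)) 2 + a

cantor′-elem : Elem₂ cantor′
cantor′-elem = elem₂ (app₂ +-elem (app₂ quot-elem (app₂ *-elem sum (app₂ +-elem sum (const-elem 1))) (const-elem 2)) π₀)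
  where sum = app₂ +-elem π₀ π₁

cantor′≡cantor : ∀ a c → cantor′ a c ≡ cantor a c
cantor′≡cantor a c = cong (_+ a) (quot≡/ ((a + c) * (a + c + 1)) 2)

fracCode : ℕ → ℕ → ℕ
fracCode D B = cantor′ (2 * quot D (searchGcd D B)) (quot B (searchGcd D B) ∸ 1)

fracCode-elem : Elem₂ fracCode
fracCode-elem = elem₂ (app₂ cantor′-elem (app₂ *-elem (const-elem 2) (app₂ quot-elem π₀ gcdD,B))
                                        (app₂ ∸-elem (app₂ quot-elem π₁ gcdD,B) (const-elem 1)))
  where gcdD,B = app₂ searchGcd-elem π₀ π₁

codeℚ-mkℚ+ : ∀ n d .{{_ : NonZero d}} .(cop : Coprime n d) → codeℚ (ℚ.mkℚ+ n d cop) ≡ cantor (2 * n) (d ∸ 1)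
codeℚ-mkℚ+ n (suc d) _ = refl

codeℚ-frac : ∀ D B .{{_ : NonZero B}} → 1 ≤ D → codeℚ (frac D B) ≡ fracCode D B
codeℚ-frac D B 1≤D = begin
  codeℚ (frac D B)                  ≡⟨ codeℚ-mkℚ+ (D / G) (B / G) {{B/G≢0}} (coprime-/gcd D B) ⟩
  cantor (2 * (D / G)) (B / G ∸ 1)  ≡⟨ cong₂ (λ x y → cantor (2 * x) (y ∸ 1)) (quot≡ D) (quot≡ B) ⟨
  cantor (2 * D′) (B′ ∸ 1)          ≡⟨ cantor′≡cantor (2 * D′) (B′ ∸ 1) ⟨
  fracCode D B                      ∎
  where
  open ≡-Reasoning
  G = gcd D B
  D′ = quot D (searchGcd D B)
  B′ = quot B (searchGcd D B)
  instance
    G≢0 : NonZero G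
    G≢0 = ≢-nonZero (gcd[m,n]≢0 D B (inj₁ (λ D≡0 → <-irrefl (sym D≡0) 1≤D)))
  B/G≢0 : NonZero (B / G)
  B/G≢0 = ≢-nonZero (n/gcd[m,n]≢0 D B)
  quot≡ : ∀ x → quot x (searchGcd D B) ≡ x / G
  quot≡ x = trans (cong (quot x) (searchGcd≡gcd D B 1≤D)) (quot≡/ x G)

-- The expansion of α^f in base b

module Expansion (f : ℕ → ℕ) (f-mono : ∀ x → f x ≤ f (suc x)) (b : ℕ) (2≤b : 2 ≤ b) where

  open ≤-Reasoning

  1≤b : 1 ≤ b
  1≤b = ≤-trans (s≤s z≤n) 2≤b

  b^≢0 : ∀ k → NonZero (b ^ k)
  b^≢0 k = >-nonZero (m^n>0 b {{>-nonZero 1≤b}} k)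

  H : ℕ → ℕ
  H i = h f i

  1≤H : ∀ i → 1 ≤ H i
  1≤H i = ≤-trans (s≤s z≤n) (j<g (f i + i))

  3H≤H[1+i] : ∀ i → 3 * H i ≤ H (suc i)
  3H≤H[1+i] i = ≤-trans (3g≤g[1+j] (f i + i))
    (g-mono (≤-trans (≤-reflexive (sym (+-suc (f i) i))) (+-monoˡ-≤ (suc i) (f-mono i))))

  -- alpha f n = N n / Q n with Q n = R 0 * ⋯ * R n.

  R : ℕ → ℕ
  R i = P i ^ H i

  Q : ℕ → ℕ
  Q zero    = R 0
  Q (suc n) = Q n * R (suc n)

  N : ℕ → ℕ
  N zero    = 1
  N (suc n) = N n * R (suc n) + Q n

  2≤R : ∀ i → 2 ≤ R i
  2≤R i = ≤-trans (P≥2 i) (m≤m^n (≤-trans (s≤s z≤n) (P≥2 i)) (1≤H i))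

  1≤R : ∀ i → 1 ≤ R i
  1≤R i = ≤-trans (s≤s z≤n) (2≤R i)

  R≢0 : ∀ i → NonZero (R i)
  R≢0 i = >-nonZero (1≤R i)

  R³≤R[1+i] : ∀ i → R i * R i * R i ≤ R (suc i)
  R³≤R[1+i] i = begin
    R i * R i * R i  ≡⟨ cube (P i) (H i) ⟩
    P i ^ (3 * H i)  ≤⟨ ^-monoʳ-≤ (P i) {{>-nonZero (≤-trans (s≤s z≤n) (P≥2 i))}} (3H≤H[1+i] i) ⟩
    P i ^ H (suc i)  ≤⟨ ^-monoˡ-≤ (H (suc i)) (<⇒≤ (P<P[1+i] i)) ⟩
    R (suc i)        ∎
    where
    cube : ∀ p k → p ^ k * p ^ k * p ^ k ≡ p ^ (3 * k)
    cube p k = begin-equality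
      p ^ k * p ^ k * p ^ k ≡⟨ cong (_* p ^ k) (^-distribˡ-+-* p k k) ⟨
      p ^ (k + k) * p ^ k   ≡⟨ ^-distribˡ-+-* p (k + k) k ⟨
      p ^ (k + k + k)       ≡⟨ cong (p ^_) (+-assoc k k k) ⟩
      p ^ (k + (k + k))     ≡⟨ cong (λ x → p ^ (k + (k + x))) (+-identityʳ k) ⟨
      p ^ (3 * k)           ∎

  2≤Q : ∀ n → 2 ≤ Q n
  2≤Q zero    = 2≤R 0
  2≤Q (suc n) = ≤-trans (2≤Q n) (m≤m*n (Q n) (R (suc n)) {{R≢0 (suc n)}})

  1≤Q : ∀ n → 1 ≤ Q n
  1≤Q n = ≤-trans (s≤s z≤n) (2≤Q n)

  Q≢0 : ∀ n → NonZero (Q n)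
  Q≢0 n = >-nonZero (1≤Q n)

  Q-mono : ∀ {n m} → n ≤ m → Q n ≤ Q m
  Q-mono {n} {m} n≤m with m≤n⇒m<n∨m≡n n≤m
  ... | inj₂ refl = ≤-refl
  Q-mono {n} {suc m} _ | inj₁ (s≤s n≤m) = ≤-trans (Q-mono n≤m) (m≤m*n (Q m) (R (suc m)) {{R≢0 (suc m)}})

  n<Q : ∀ n → n < Q n
  n<Q zero    = 1≤Q 0
  n<Q (suc n) = begin-strict
    suc n             <⟨ +-monoʳ-≤ 1 (n<Q n) ⟩
    1 + Q n           ≤⟨ +-monoˡ-≤ (Q n) (1≤Q n) ⟩
    Q n + Q n         ≡⟨ cong (Q n +_) (+-identityʳ (Q n)) ⟨
    2 * Q n           ≡⟨ *-comm 2 (Q n) ⟩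
    Q n * 2           ≤⟨ *-monoʳ-≤ (Q n) (2≤R (suc n)) ⟩
    Q n * R (suc n)   ∎

  Q²≤R[1+n] : ∀ n → Q n * Q n ≤ R (suc n)
  Q²≤R[1+n] zero    = ≤-trans (m≤m*n (R 0 * R 0) (R 0) {{R≢0 0}}) (R³≤R[1+i] 0)
  Q²≤R[1+n] (suc n) = begin
    Q n * r * (Q n * r) ≡⟨ ring (Q n) r ⟩
    Q n * Q n * (r * r) ≤⟨ *-monoˡ-≤ (r * r) (Q²≤R[1+n] n) ⟩
    r * (r * r)         ≡⟨ *-assoc r r r ⟨
    r * r * r           ≤⟨ R³≤R[1+i] (suc n) ⟩
    R (suc (suc n))     ∎
    where
    r = R (suc n)
    ring : ∀ q r → q * r * (q * r) ≡ q * q * (r * r)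
    ring = solve-∀

  Q<R[1+n] : ∀ n → Q n < R (suc n)
  Q<R[1+n] n = begin-strict
    Q n         <⟨ m<m*n (Q n) 2 {{Q≢0 n}} (s≤s (s≤s z≤n)) ⟩
    Q n * 2     ≤⟨ *-monoʳ-≤ (Q n) (2≤Q n) ⟩
    Q n * Q n   ≤⟨ Q²≤R[1+n] n ⟩
    R (suc n)   ∎

  N<Q : ∀ n → N n < Q n
  N<Q zero    = 2≤R 0
  N<Q (suc n) = begin-strict
    N n * r + Q n  <⟨ +-monoʳ-< (N n * r) (Q<R[1+n] n) ⟩
    N n * r + r    ≡⟨ +-comm (N n * r) r ⟩
    suc (N n) * r  ≤⟨ *-monoˡ-≤ r (N<Q n) ⟩
    Q n * r        ∎
    where r = R (suc n)

  -- From a stable n on, ⌊bᵐ * N n / Q n⌋ no longer changes (brackets).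
  Stable : ℕ → ℕ → Set
  Stable m n = b ^ m * Q n < R (suc n)

  stable-suc : ∀ m {n} → Stable m n → Stable m (suc n)
  stable-suc m {n} stable = begin-strict
    b ^ m * (Q n * r) ≡⟨ *-assoc (b ^ m) (Q n) r ⟨
    b ^ m * Q n * r   <⟨ *-monoˡ-< r {{R≢0 (suc n)}} stable ⟩
    r * r             ≤⟨ m≤m*n (r * r) r {{R≢0 (suc n)}} ⟩
    r * r * r         ≤⟨ R³≤R[1+i] (suc n) ⟩
    R (suc (suc n))   ∎
    where r = R (suc n)

  stable-mono : ∀ m {n n′} → n ≤ n′ → Stable m n → Stable m n′
  stable-mono m {n} {n′} n≤n′ stable with m≤n⇒m<n∨m≡n n≤n′
  ... | inj₂ refl = stable
  stable-mono m {n} {suc n′} _ stable | inj₁ (s≤s n≤n′) = stable-suc m (stable-mono m n≤n′ stable)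

  ¬stable⇒Q≤b^m : ∀ m {n} → ¬ Stable m n → Q n ≤ b ^ m
  ¬stable⇒Q≤b^m m {n} unstable =
    *-cancelʳ-≤ (Q n) (b ^ m) (Q n) {{Q≢0 n}} (≤-trans (Q²≤R[1+n] n) (≮⇒≥ unstable))

  stable-b^m : ∀ m → Stable m (b ^ m)
  stable-b^m m with b ^ m * Q (b ^ m) <? R (suc (b ^ m))
  ... | yes stable   = stable
  ... | no  unstable = ⊥-elim (<-irrefl refl (≤-trans (n<Q (b ^ m)) (¬stable⇒Q≤b^m m unstable)))

  settle : ℕ → ℕ
  settle m = mu (b ^ m) (λ n → R (suc n) ∸ b ^ m * Q n)

  settle-stable : ∀ m → Stable m (settle m)
  settle-stable m with m≤n⇒m<n∨m≡n (mu≤ (b ^ m) (λ n → R (suc n) ∸ b ^ m * Q n))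
  ... | inj₁ lt = m∸n≢0⇒n<m (mu-found (b ^ m) (λ n → R (suc n) ∸ b ^ m * Q n) lt)
  ... | inj₂ eq = subst (Stable m) (sym eq) (stable-b^m m)

  <settle⇒¬stable : ∀ m {n} → n < settle m → ¬ Stable m n
  <settle⇒¬stable m {n} n<settle stable =
    <-irrefl refl (≤-trans stable (m∸n≡0⇒m≤n (mu-least (b ^ m) (λ n → R (suc n) ∸ b ^ m * Q n) n n<settle)))

  QBound : ℕ → ℕ
  QBound m = b ^ m * b ^ m * b ^ m + R 0

  Q≤QBound : ∀ m n → n ≤ settle m → Q n ≤ QBound m
  Q≤QBound m n n≤settle = ≤-trans (Q-mono n≤settle) (unstable-below (settle m) (<settle⇒¬stable m))
    where
    unstable-below : ∀ n → (∀ {k} → k < n → ¬ Stable m k) → Q n ≤ QBound m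
    unstable-below zero    _        = m≤n+m (R 0) _
    unstable-below (suc k) unstable = ≤-trans (begin
      Q k * R (suc k)          ≤⟨ *-mono-≤ Q≤b^m (≮⇒≥ (unstable ≤-refl)) ⟩
      b ^ m * (b ^ m * Q k)    ≤⟨ *-monoʳ-≤ (b ^ m) (*-monoʳ-≤ (b ^ m) Q≤b^m) ⟩
      b ^ m * (b ^ m * b ^ m)  ≡⟨ *-assoc (b ^ m) (b ^ m) (b ^ m) ⟨
      b ^ m * b ^ m * b ^ m    ∎) (m≤m+n _ (R 0))
      where Q≤b^m = ¬stable⇒Q≤b^m m (unstable ≤-refl)

  -- trunc m = ⌊bᵐ α^f⌋
  trunc : ℕ → ℕ
  trunc m = (b ^ m * N (settle m) / Q (settle m)) {{Q≢0 (settle m)}}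

  Brackets : ℕ → ℕ → Set
  Brackets m n = trunc m * Q n ≤ b ^ m * N n × b ^ m * N n < suc (trunc m) * Q n

  brackets-settle : ∀ m → Brackets m (settle m)
  brackets-settle m = m/n*n≤m X q , X<[1+X/q]q
    where
    X = b ^ m * N (settle m)
    q = Q (settle m)
    instance _ = Q≢0 (settle m)
    X<[1+X/q]q : X < suc (X / q) * q
    X<[1+X/q]q = begin-strict
      X                 ≡⟨ m≡m%n+[m/n]*n X q ⟩
      X % q + X / q * q <⟨ +-monoˡ-< (X / q * q) (m%n<n X q) ⟩
      q + X / q * q     ∎

  brackets-suc : ∀ m {n} → Stable m n → Brackets m n → Brackets m (suc n)
  brackets-suc m {n} stable (lower , upper) = lower′ , upper′
    where
    r = R (suc n)
    t = trunc m
    reassoc : ∀ t q r → t * (q * r) ≡ t * q * r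
    reassoc = solve-∀
    distrib : ∀ B a r q → B * (a * r + q) ≡ B * a * r + B * q
    distrib = solve-∀
    lower′ : t * (Q n * r) ≤ b ^ m * (N n * r + Q n)
    lower′ = begin
      t * (Q n * r)                  ≡⟨ reassoc t (Q n) r ⟩
      t * Q n * r                    ≤⟨ *-monoˡ-≤ r lower ⟩
      b ^ m * N n * r                ≤⟨ m≤m+n _ _ ⟩
      b ^ m * N n * r + b ^ m * Q n  ≡⟨ distrib (b ^ m) (N n) r (Q n) ⟨
      b ^ m * (N n * r + Q n)        ∎
    upper′ : b ^ m * (N n * r + Q n) < suc t * (Q n * r)
    upper′ = begin-strict
      b ^ m * (N n * r + Q n)        ≡⟨ distrib (b ^ m) (N n) r (Q n) ⟩
      b ^ m * N n * r + b ^ m * Q n  <⟨ +-monoʳ-< (b ^ m * N n * r) stable ⟩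
      b ^ m * N n * r + r            ≡⟨ +-comm (b ^ m * N n * r) r ⟩
      suc (b ^ m * N n) * r          ≤⟨ *-monoˡ-≤ r upper ⟩
      suc t * Q n * r                ≡⟨ reassoc (suc t) (Q n) r ⟨
      suc t * (Q n * r)              ∎

  brackets : ∀ m {n} → settle m ≤ n → Brackets m n
  brackets m {n} settle≤n = subst (Brackets m) (m+[n∸m]≡n settle≤n) (from-settle (n ∸ settle m))
    where
    from-settle : ∀ k → Brackets m (settle m + k)
    from-settle zero    = subst (Brackets m) (sym (+-identityʳ (settle m))) (brackets-settle m)
    from-settle (suc k) = subst (Brackets m) (sym (+-suc (settle m) k))
      (brackets-suc m (stable-mono m (m≤m+n (settle m) k) (settle-stable m)) (from-settle k))

  digit : ℕ → ℕ
  digit zero    = 0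
  digit (suc m) = trunc (suc m) ∸ b * trunc m

  trunc-zero : trunc 0 ≡ 0
  trunc-zero = m<n⇒m/n≡0 {{Q≢0 (settle 0)}} (subst (_< Q (settle 0)) (sym (+-identityʳ (N (settle 0)))) (N<Q (settle 0)))

  trunc-suc-bounds : ∀ m → b * trunc m ≤ trunc (suc m) × trunc (suc m) < b * trunc m + b
  trunc-suc-bounds m = lower , upper
    where
    n = settle m ⊔ settle (suc m)
    t = trunc m
    t′ = trunc (suc m)
    here = brackets m (m≤m⊔n (settle m) (settle (suc m)))
    next = brackets (suc m) (m≤n⊔m (settle m) (settle (suc m)))
    reassoc : ∀ b t q → b * (t * q) ≡ b * t * q
    reassoc = solve-∀
    lower : b * t ≤ t′
    lower = ≤-pred (*-cancelʳ-< (Q n) (b * t) (suc t′) (begin-strict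
      b * t * Q n       ≡⟨ reassoc b t (Q n) ⟨
      b * (t * Q n)     ≤⟨ *-monoʳ-≤ b (proj₁ here) ⟩
      b * (b ^ m * N n) ≡⟨ *-assoc b (b ^ m) (N n) ⟨
      b ^ suc m * N n   <⟨ proj₂ next ⟩
      suc t′ * Q n      ∎))
    distrib : ∀ b t q → b * (suc t * q) ≡ (b * t + b) * q
    distrib = solve-∀
    upper : t′ < b * t + b
    upper = *-cancelʳ-< (Q n) t′ (b * t + b) (begin-strict
      t′ * Q n           ≤⟨ proj₁ next ⟩
      b ^ suc m * N n    ≡⟨ *-assoc b (b ^ m) (N n) ⟩
      b * (b ^ m * N n)  <⟨ *-monoʳ-< b {{>-nonZero 1≤b}} (proj₂ here) ⟩
      b * (suc t * Q n)  ≡⟨ distrib b t (Q n) ⟩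
      (b * t + b) * Q n  ∎)

  trunc-suc : ∀ m → trunc (suc m) ≡ b * trunc m + digit (suc m)
  trunc-suc m = sym (m+[n∸m]≡n (proj₁ (trunc-suc-bounds m)))

  digit<b : ∀ m → digit m < b
  digit<b zero    = ≤-trans (s≤s z≤n) 2≤b
  digit<b (suc m) = +-cancelˡ-< (b * trunc m) (digit (suc m)) b
    (subst (_< b * trunc m + b) (trunc-suc m) (proj₂ (trunc-suc-bounds m)))

  trunc-+ : ∀ m k → b ^ k * trunc m ≤ trunc (m + k)
  trunc-+ m zero    = ≤-reflexive (trans (*-identityˡ (trunc m)) (cong trunc (sym (+-identityʳ m))))
  trunc-+ m (suc k) = begin
    b * b ^ k * trunc m    ≡⟨ *-assoc b (b ^ k) (trunc m) ⟩
    b * (b ^ k * trunc m)  ≤⟨ *-monoʳ-≤ b (trunc-+ m k) ⟩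
    b * trunc (m + k)      ≤⟨ proj₁ (trunc-suc-bounds (m + k)) ⟩
    trunc (suc (m + k))    ≡⟨ cong trunc (+-suc m k) ⟨
    trunc (m + suc k)      ∎

  trunc-scaled-mono : ∀ {m k} → m ≤ k → trunc m * b ^ k ≤ trunc k * b ^ m
  trunc-scaled-mono {m} {k} m≤k = begin
    trunc m * b ^ k             ≡⟨ cong (λ z → trunc m * b ^ z) k≡m+j ⟩
    trunc m * b ^ (m + j)       ≡⟨ cong (trunc m *_) (^-distribˡ-+-* b m j) ⟩
    trunc m * (b ^ m * b ^ j)   ≡⟨ reorder (trunc m) (b ^ m) (b ^ j) ⟩
    b ^ j * trunc m * b ^ m     ≤⟨ *-monoˡ-≤ (b ^ m) (trunc-+ m j) ⟩
    trunc (m + j) * b ^ m       ≡⟨ cong (λ z → trunc z * b ^ m) k≡m+j ⟨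
    trunc k * b ^ m             ∎
    where
    j = k ∸ m
    k≡m+j : k ≡ m + j
    k≡m+j = sym (m+[n∸m]≡n m≤k)
    reorder : ∀ t x y → t * (x * y) ≡ y * t * x
    reorder = solve-∀

  ZeroRun : ℕ → ℕ → Set
  ZeroRun m G = ∀ L → 1 ≤ L → L ≤ G → digit (m + L) ≡ 0

  trunc-zeroRun : ∀ m G → ZeroRun m G → trunc (m + G) ≡ b ^ G * trunc m
  trunc-zeroRun m zero    _     = trans (cong trunc (+-identityʳ m)) (sym (+-identityʳ (trunc m)))
  trunc-zeroRun m (suc G) zeros = begin-equality
    trunc (m + suc G)                        ≡⟨ cong trunc (+-suc m G) ⟩
    trunc (suc (m + G))                      ≡⟨ trunc-suc (m + G) ⟩
    b * trunc (m + G) + digit (suc (m + G))  ≡⟨ cong₂ _+_ (cong (b *_) (trunc-zeroRun m G shorter)) last-zero ⟩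
    b * (b ^ G * trunc m) + 0                ≡⟨ +-identityʳ _ ⟩
    b * (b ^ G * trunc m)                    ≡⟨ *-assoc b (b ^ G) (trunc m) ⟨
    b ^ suc G * trunc m                      ∎
    where
    shorter : ZeroRun m G
    shorter L 1≤L L≤G = zeros L 1≤L (m≤n⇒m≤1+n L≤G)
    last-zero : digit (suc (m + G)) ≡ 0
    last-zero = trans (cong digit (sym (+-suc m G))) (zeros (suc G) (s≤s z≤n) ≤-refl)

  P[b]∤b^ : ∀ k → ¬ P b ∣ b ^ k
  P[b]∤b^ k P[b]∣b^k = <-irrefl refl (begin-strict
    b      <⟨ m<m+n b {2} (s≤s z≤n) ⟩
    b + 2  ≤⟨ P≥i+2 b ⟩
    P b    ≤⟨ ∣⇒≤ {{>-nonZero 1≤b}} (prime∣^⇒∣ b k (P-prime b) P[b]∣b^k) ⟩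
    b      ∎)

  P[b]∣R⇒≡b : ∀ {j} → P b ∣ R j → j ≡ b
  P[b]∣R⇒≡b {j} P[b]∣R with prime⇒irreducible (P-prime j) (prime∣^⇒∣ (P j) (H j) (P-prime b) P[b]∣R)
  ... | inj₁ P[b]≡1 = ⊥-elim (<-irrefl (sym P[b]≡1) (P≥2 b))
  ... | inj₂ P[b]≡P[j] = sym (P-injective P[b]≡P[j])

  P[b]∣R[b] : P b ∣ R b
  P[b]∣R[b] with H b | 1≤H b
  ... | suc k | _ = m∣m*n (P b ^ k)

  R∣Q : ∀ {j n} → j ≤ n → R j ∣ Q n
  R∣Q {j} {zero}  z≤n = ∣-refl
  R∣Q {j} {suc n} j≤1+n with m≤n⇒m<n∨m≡n j≤1+n
  ... | inj₂ refl      = n∣m*n (Q n)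
  ... | inj₁ (s≤s j≤n) = ∣-trans (R∣Q j≤n) (m∣m*n (R (suc n)))

  P[b]∣Q : ∀ {n} → b ≤ n → P b ∣ Q n
  P[b]∣Q b≤n = ∣-trans P[b]∣R[b] (R∣Q b≤n)

  P[b]∤Q : ∀ {n} → n < b → ¬ P b ∣ Q n
  P[b]∤Q {zero}  0<b P[b]∣Q = <-irrefl (P[b]∣R⇒≡b P[b]∣Q) 0<b
  P[b]∤Q {suc n} n<b P[b]∣Q with euclidsLemma (Q n) (R (suc n)) (P-prime b) P[b]∣Q
  ... | inj₁ P[b]∣Q[n] = P[b]∤Q (<-trans (n<1+n n) n<b) P[b]∣Q[n]
  ... | inj₂ P[b]∣R    = <-irrefl (P[b]∣R⇒≡b P[b]∣R) n<b

  P[b]∤N : ∀ {n} → b ≤ n → ¬ P b ∣ N n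
  P[b]∤N {zero}  _   P[b]∣1 = prime∤1 (P-prime b) P[b]∣1
  P[b]∤N {suc n} b≤n P[b]∣N with m≤n⇒m<n∨m≡n b≤n
  ... | inj₂ refl = P[b]∤Q (n<1+n n) (∣m+n∣m⇒∣n P[b]∣N (∣-trans P[b]∣R[b] (n∣m*n (N n))))
  ... | inj₁ (s≤s b≤n′) with euclidsLemma (N n) (R (suc n)) (P-prime b)
                               (∣m+n∣m⇒∣n (subst (P b ∣_) (+-comm (N n * R (suc n)) (Q n)) P[b]∣N) (P[b]∣Q b≤n′))
  ...   | inj₁ P[b]∣N[n] = P[b]∤N b≤n′ P[b]∣N[n]
  ...   | inj₂ P[b]∣R    = <-irrefl (sym (P[b]∣R⇒≡b P[b]∣R)) (s≤s b≤n′)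

  gapConst : ℕ
  gapConst = R 0 + Q b

  gapBound : ℕ → ℕ
  gapBound m = 3 * m + gapConst

  -- The remainder bᵐ * N n − trunc m * Q n is positive at n₀, as P b divides Q n₀ but not bᵐ * N n₀,
  -- and from then on grows like Q n / Q n₀; a run of gapBound m zero digits after m would force
  -- bᵐ⁺ᴳ * remainder < Q n, i.e. b ^ gapBound m < Q n₀, which the bounds on settle m forbid.
  private module Gap (m : ℕ) where

    n₀ = settle m ⊔ b

    remainder : ℕ → ℕ
    remainder n = b ^ m * N n ∸ trunc m * Q n

    b^m*N≡ : ∀ {n} → settle m ≤ n → b ^ m * N n ≡ trunc m * Q n + remainder n
    b^m*N≡ settle≤n = sym (m+[n∸m]≡n (proj₁ (brackets m settle≤n)))

    remainder-n₀-positive : 1 ≤ remainder n₀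
    remainder-n₀-positive with remainder n₀ in eq
    ... | suc _ = s≤s z≤n
    ... | zero  = ⊥-elim (P[b]∤b^m*N (subst (P b ∣_) (sym exact)
                    (∣-trans (P[b]∣Q (m≤n⊔m (settle m) b)) (n∣m*n (trunc m)))))
      where
      exact : b ^ m * N n₀ ≡ trunc m * Q n₀
      exact = trans (b^m*N≡ (m≤m⊔n _ _)) (trans (cong (trunc m * Q n₀ +_) eq) (+-identityʳ _))
      P[b]∤b^m*N : ¬ P b ∣ b ^ m * N n₀
      P[b]∤b^m*N P[b]∣ with euclidsLemma (b ^ m) (N n₀) (P-prime b) P[b]∣
      ... | inj₁ P[b]∣b^m = P[b]∤b^ m P[b]∣b^m
      ... | inj₂ P[b]∣N   = P[b]∤N (m≤n⊔m (settle m) b) P[b]∣N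

    remainder-suc : ∀ n → settle m ≤ n → remainder n * R (suc n) ≤ remainder (suc n)
    remainder-suc n settle≤n = ≤-trans (m≤m+n (remainder n * r) (b ^ m * Q n)) (≤-reflexive (sym next))
      where
      r = R (suc n)
      t = trunc m
      distrib : ∀ B a r q → B * (a * r + q) ≡ B * a * r + B * q
      distrib = solve-∀
      regroup : ∀ t q s r B → (t * q + s) * r + B * q ≡ t * (q * r) + (s * r + B * q)
      regroup = solve-∀
      b^m*N[1+n] : b ^ m * N (suc n) ≡ t * (Q n * r) + (remainder n * r + b ^ m * Q n)
      b^m*N[1+n] = trans (distrib (b ^ m) (N n) r (Q n))
        (trans (cong (λ x → x * r + b ^ m * Q n) (b^m*N≡ settle≤n)) (regroup t (Q n) (remainder n) r (b ^ m)))
      next : remainder (suc n) ≡ remainder n * r + b ^ m * Q n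
      next = trans (cong (_∸ t * (Q n * r)) b^m*N[1+n]) (m+n∸m≡n (t * (Q n * r)) _)

    Q≤Q[n₀]*remainder : ∀ n → n₀ ≤ n → Q n ≤ Q n₀ * remainder n
    Q≤Q[n₀]*remainder n n₀≤n = subst (λ x → Q x ≤ Q n₀ * remainder x) (m+[n∸m]≡n n₀≤n) (from-n₀ (n ∸ n₀))
      where
      from-n₀ : ∀ k → Q (n₀ + k) ≤ Q n₀ * remainder (n₀ + k)
      from-n₀ zero rewrite +-identityʳ n₀ =
        ≤-trans (≤-reflexive (sym (*-identityʳ (Q n₀)))) (*-monoʳ-≤ (Q n₀) remainder-n₀-positive)
      from-n₀ (suc k) rewrite +-suc n₀ k = begin
        Q (n₀ + k) * r                      ≤⟨ *-monoˡ-≤ r (from-n₀ k) ⟩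
        Q n₀ * remainder (n₀ + k) * r       ≡⟨ *-assoc (Q n₀) (remainder (n₀ + k)) r ⟩
        Q n₀ * (remainder (n₀ + k) * r)     ≤⟨ *-monoʳ-≤ (Q n₀) (remainder-suc (n₀ + k)
                                                   (≤-trans (m≤m⊔n (settle m) b) (m≤m+n n₀ k))) ⟩
        Q n₀ * remainder (suc (n₀ + k))     ∎
        where r = R (suc (n₀ + k))

    Q[n₀]≤b^gapBound : Q n₀ ≤ b ^ gapBound m
    Q[n₀]≤b^gapBound = begin
      Q n₀                  ≤⟨ Q[n₀]≤ ⟩
      Y + R 0 + Q b         ≡⟨ +-assoc Y (R 0) (Q b) ⟩
      Y + gapConst          ≤⟨ +-monoʳ-≤ Y (m≤n*m gapConst Y {{>-nonZero 1≤Y}}) ⟩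
      Y + Y * gapConst      ≡⟨ cong (_+ Y * gapConst) (*-identityʳ Y) ⟨
      Y * 1 + Y * gapConst  ≡⟨ *-distribˡ-+ Y 1 gapConst ⟨
      Y * (1 + gapConst)    ≤⟨ *-monoʳ-≤ Y (n<m^n b gapConst 2≤b) ⟩
      Y * b ^ gapConst      ≡⟨ cong (_* b ^ gapConst) b^[3m]≡Y ⟨
      b ^ (3 * m) * b ^ gapConst ≡⟨ ^-distribˡ-+-* b (3 * m) gapConst ⟨
      b ^ gapBound m        ∎
      where
      Y = b ^ m * b ^ m * b ^ m
      b^[3m]≡Y : b ^ (3 * m) ≡ Y
      b^[3m]≡Y = begin-equality
        b ^ (3 * m)                  ≡⟨ cong (λ x → b ^ (m + (m + x))) (+-identityʳ m) ⟩
        b ^ (m + (m + m))            ≡⟨ ^-distribˡ-+-* b m (m + m) ⟩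
        b ^ m * b ^ (m + m)          ≡⟨ cong (b ^ m *_) (^-distribˡ-+-* b m m) ⟩
        b ^ m * (b ^ m * b ^ m)      ≡⟨ *-assoc (b ^ m) (b ^ m) (b ^ m) ⟨
        Y                            ∎
      1≤Y : 1 ≤ Y
      1≤Y = subst (1 ≤_) b^[3m]≡Y (m^n>0 b {{>-nonZero 1≤b}} (3 * m))
      Q[n₀]≤ : Q n₀ ≤ Y + R 0 + Q b
      Q[n₀]≤ with ≤-total (settle m) b
      ... | inj₁ settle≤b rewrite m≤n⇒m⊔n≡n settle≤b = m≤n+m (Q b) (Y + R 0)
      ... | inj₂ b≤settle rewrite m≥n⇒m⊔n≡m b≤settle =
        ≤-trans (Q≤QBound m (settle m) ≤-refl) (m≤m+n (Y + R 0) (Q b))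

    ¬zeroRun : ¬ ZeroRun m (gapBound m)
    ¬zeroRun zeros = <-irrefl refl (≤-trans b^G<Q[n₀] Q[n₀]≤b^gapBound)
      where
      G = gapBound m
      n = n₀ ⊔ settle (m + G)
      B = b ^ G
      settle≤n : settle m ≤ n
      settle≤n = ≤-trans (m≤m⊔n (settle m) b) (m≤m⊔n n₀ _)
      lhs : b ^ (m + G) * N n ≡ B * (trunc m * Q n) + B * remainder n
      lhs = begin-equality
        b ^ (m + G) * N n                ≡⟨ cong (_* N n) (^-distribˡ-+-* b m G) ⟩
        b ^ m * B * N n                  ≡⟨ swap (b ^ m) B (N n) ⟩
        B * (b ^ m * N n)                ≡⟨ cong (B *_) (b^m*N≡ settle≤n) ⟩
        B * (trunc m * Q n + remainder n) ≡⟨ *-distribˡ-+ B (trunc m * Q n) (remainder n) ⟩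
        B * (trunc m * Q n) + B * remainder n ∎
        where
        swap : ∀ a c d → a * c * d ≡ c * (a * d)
        swap = solve-∀
      rhs : suc (trunc (m + G)) * Q n ≡ B * (trunc m * Q n) + Q n
      rhs = trans (cong (λ x → suc x * Q n) (trunc-zeroRun m G zeros)) (expand B (trunc m) (Q n))
        where
        expand : ∀ a t q → suc (a * t) * q ≡ a * (t * q) + q
        expand = solve-∀
      B*remainder<Q : B * remainder n < Q n
      B*remainder<Q = +-cancelˡ-< (B * (trunc m * Q n)) (B * remainder n) (Q n)
        (subst₂ _<_ lhs rhs (proj₂ (brackets (m + G) (m≤n⊔m n₀ _))))
      b^G<Q[n₀] : B < Q n₀
      b^G<Q[n₀] = *-cancelʳ-< (remainder n) B (Q n₀)
        (≤-trans B*remainder<Q (Q≤Q[n₀]*remainder n (m≤m⊔n n₀ _)))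

  ¬zeroRun-gapBound : ∀ m → ¬ ZeroRun m (gapBound m)
  ¬zeroRun-gapBound = Gap.¬zeroRun

  gapAfter : ℕ → ℕ
  gapAfter k = mu (gapBound k) (λ L → digit (k + suc L))

  gapAfter<gapBound : ∀ k → gapAfter k < gapBound k
  gapAfter<gapBound k with m≤n⇒m<n∨m≡n (mu≤ (gapBound k) (λ L → digit (k + suc L)))
  ... | inj₁ lt = lt
  ... | inj₂ eq = ⊥-elim (¬zeroRun-gapBound k zeros)
    where
    zeros : ZeroRun k (gapBound k)
    zeros (suc L) _ L<G = mu-least (gapBound k) (λ L → digit (k + suc L)) L (subst (L <_) (sym eq) L<G)

  zeroRun-gapAfter : ∀ k → ZeroRun k (gapAfter k)
  zeroRun-gapAfter k (suc L) _ L<gap = mu-least (gapBound k) (λ L → digit (k + suc L)) L L<gap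

  digit-after-gap≢0 : ∀ k → digit (k + suc (gapAfter k)) ≢ 0
  digit-after-gap≢0 k = mu-found (gapBound k) (λ L → digit (k + suc L)) (gapAfter<gapBound k)

  position : ℕ → ℕ
  position zero    = 0
  position (suc i) = position i + suc (gapAfter (position i))

  position-< : ∀ i → position i < position (suc i)
  position-< i = m<m+n (position i) (s≤s z≤n)

  i≤position : ∀ i → i ≤ position i
  i≤position zero    = z≤n
  i≤position (suc i) = ≤-trans (s≤s (i≤position i)) (position-< i)

  trunc-position-suc : ∀ i → trunc (position (suc i))
                             ≡ b ^ suc (gapAfter (position i)) * trunc (position i) + digit (position (suc i))
  trunc-position-suc i = begin-equality
    trunc (k + suc G)                          ≡⟨ cong trunc (+-suc k G) ⟩
    trunc (suc (k + G))                        ≡⟨ trunc-suc (k + G) ⟩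
    b * trunc (k + G) + digit (suc (k + G))    ≡⟨ cong₂ _+_ (cong (b *_) (trunc-zeroRun k G (zeroRun-gapAfter k)))
                                                            (cong digit (sym (+-suc k G))) ⟩
    b * (b ^ G * trunc k) + digit (k + suc G)  ≡⟨ cong (_+ digit (k + suc G)) (*-assoc b (b ^ G) (trunc k)) ⟨
    b ^ suc G * trunc k + digit (k + suc G)    ∎
    where
    k = position i
    G = gapAfter k

  positionBound : ℕ → ℕ
  positionBound i = suc gapConst * 5 ^ i

  position≤positionBound : ∀ i → position i ≤ positionBound i
  position≤positionBound zero    = z≤n
  position≤positionBound (suc i) = begin
    position i + suc (gapAfter (position i))  ≤⟨ +-monoʳ-≤ (position i) (gapAfter<gapBound (position i)) ⟩
    position i + (3 * position i + gapConst)  ≤⟨ +-mono-≤ ih (+-mono-≤ (*-monoʳ-≤ 3 ih) gapConst≤) ⟩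
    B + (3 * B + B)                           ≡⟨ ring (suc gapConst) (5 ^ i) ⟩
    suc gapConst * (5 * 5 ^ i)                ∎
    where
    B = positionBound i
    ih = position≤positionBound i
    gapConst≤ : gapConst ≤ B
    gapConst≤ = ≤-trans (n≤1+n gapConst) (m≤m*n (suc gapConst) (5 ^ i) {{>-nonZero (m^n>0 5 i)}})
    ring : ∀ c p → c * p + (3 * (c * p) + c * p) ≡ c * (5 * p)
    ring = solve-∀

module Approximation (f : ℕ → ℕ) (f-mono : ∀ x → f x ≤ f (suc x)) (b : ℕ) (2≤b : 2 ≤ b) where

  open Expansion f f-mono b 2≤b
  open ≡-Reasoning

  A : ℕ → ℚ
  A zero    = 0ℚ
  A (suc i) = frac (digit (position (suc i))) 1 ℚ.* recip (b ^ position (suc i))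

  alpha≡N/Q : ∀ n → alpha f n ≡ frac (N n) (Q n) {{Q≢0 n}}
  alpha≡N/Q zero    = recip≡frac (R 0) {{R≢0 0}}
  alpha≡N/Q (suc n) = begin
    alpha f n ℚ.+ recip r              ≡⟨ cong₂ ℚ._+_ (alpha≡N/Q n) (recip≡frac r) ⟩
    frac (N n) (Q n) ℚ.+ frac 1 r      ≡⟨ frac-+ (N n) (Q n) 1 r ⟩
    frac (N n * r + 1 * Q n) (Q n * r) {{m*n≢0 (Q n) r}}
                                       ≡⟨ frac-cong (N n * r + 1 * Q n) (Q n * r) (N (suc n)) (Q (suc n)) {{m*n≢0 (Q n) r}}
                                            (cong (λ x → (N n * r + x) * Q (suc n)) (*-identityˡ (Q n))) ⟩
    frac (N (suc n)) (Q (suc n))       ∎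
    where
    r = R (suc n)
    instance
      _ = Q≢0 n
      _ = R≢0 (suc n)
      _ = Q≢0 (suc n)

  sumTo-A≡trunc/b^ : ∀ i → sumTo A i ≡ frac (trunc (position i)) (b ^ position i) {{b^≢0 (position i)}}
  sumTo-A≡trunc/b^ zero    = trans (frac-zero 1) (cong (λ t → frac t 1) (sym trunc-zero))
  sumTo-A≡trunc/b^ (suc i) = begin
    sumTo A i ℚ.+ A (suc i)                    ≡⟨ cong₂ ℚ._+_ (sumTo-A≡trunc/b^ i) (frac-*-recip D (b ^ k′)) ⟩
    frac (trunc k) (b ^ k) ℚ.+ frac D (b ^ k′) ≡⟨ frac-+ (trunc k) (b ^ k) D (b ^ k′) ⟩
    frac numerator (b ^ k * b ^ k′) {{bᵏbᵏ′≢0}} ≡⟨ frac-cong numerator (b ^ k * b ^ k′) (trunc k′) (b ^ k′) {{bᵏbᵏ′≢0}} cross ⟩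
    frac (trunc k′) (b ^ k′)                   ∎
    where
    k = position i
    k′ = position (suc i)
    D = digit k′
    Δ = suc (gapAfter k)
    numerator = trunc k * b ^ k′ + D * b ^ k
    bᵏbᵏ′≢0 = m*n≢0 (b ^ k) (b ^ k′) {{b^≢0 k}} {{b^≢0 k′}}
    instance
      _ = b^≢0 k
      _ = b^≢0 k′
    b^k′≡ : b ^ k′ ≡ b ^ k * b ^ Δ
    b^k′≡ = ^-distribˡ-+-* b k Δ
    ring : ∀ t x y d → (t * (x * y) + d * x) * (x * y) ≡ (y * t + d) * (x * (x * y))
    ring = solve-∀
    cross : numerator * b ^ k′ ≡ trunc k′ * (b ^ k * b ^ k′)
    cross = trans (cong (λ z → (trunc k * z + D * b ^ k) * z) b^k′≡)
              (trans (ring (trunc k) (b ^ k) (b ^ Δ) D)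
                (cong₂ (λ x y → x * (b ^ k * y)) (sym (trunc-position-suc i)) (sym b^k′≡)))

  alpha-mono : ∀ n k → alpha f n ℚ.≤ alpha f (n + k)
  alpha-mono n zero    rewrite +-identityʳ n = ℚP.≤-refl
  alpha-mono n (suc k) rewrite +-suc n k = ℚP.≤-trans (alpha-mono n k)
    (subst₂ ℚ._≤_ (sym (alpha≡N/Q (n + k))) (sym (alpha≡N/Q (suc (n + k))))
      (frac-mono-≤ (N j) (Q j) (N (suc j)) (Q (suc j)) {{Q≢0 j}} {{Q≢0 (suc j)}} N/Q≤))
    where
    j = n + k
    r = R (suc j)
    reorder : ∀ a q r → a * (q * r) ≡ a * r * q
    reorder = solve-∀
    N/Q≤ : N j * (Q j * r) ≤ (N j * r + Q j) * Q j
    N/Q≤ = ≤-trans (≤-reflexive (reorder (N j) (Q j) r)) (*-monoˡ-≤ (Q j) (m≤m+n (N j * r) (Q j)))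

  ≤+nonneg : ∀ p ε → 0ℚ ℚ.≤ ε → p ℚ.≤ p ℚ.+ ε
  ≤+nonneg p ε 0≤ε = subst (ℚ._≤ p ℚ.+ ε) (ℚP.+-identityʳ p) (ℚP.+-mono-≤ (ℚP.≤-refl {p}) 0≤ε)

  sumTo-A≤alpha : SupLe (sumTo A) (alpha f)
  sumTo-A≤alpha i ε 0<ε = settle k , ℚP.≤-trans sumTo-A≤ (≤+nonneg _ ε (ℚP.<⇒≤ 0<ε))
    where
    k = position i
    n = settle k
    sumTo-A≤ : sumTo A i ℚ.≤ alpha f n
    sumTo-A≤ = subst₂ ℚ._≤_ (sym (sumTo-A≡trunc/b^ i)) (sym (alpha≡N/Q n))
      (frac-mono-≤ (trunc k) (b ^ k) (N n) (Q n) {{b^≢0 k}} {{Q≢0 n}}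
        (≤-trans (proj₁ (brackets k ≤-refl)) (≤-reflexive (*-comm (b ^ k) (N n)))))

  alpha≤[trunc+1]/b^ : ∀ m {n} → settle m ≤ n → alpha f n ℚ.≤ frac (suc (trunc m)) (b ^ m) {{b^≢0 m}}
  alpha≤[trunc+1]/b^ m {n} settle≤n = subst (ℚ._≤ frac (suc (trunc m)) (b ^ m) {{b^≢0 m}}) (sym (alpha≡N/Q n))
    (frac-mono-≤ (N n) (Q n) (suc (trunc m)) (b ^ m) {{Q≢0 n}} {{b^≢0 m}}
      (≤-trans (≤-reflexive (*-comm (N n) (b ^ m))) (<⇒≤ (proj₂ (brackets m settle≤n)))))

  trunc/b^≤sumTo-A : ∀ m → frac (trunc m) (b ^ m) {{b^≢0 m}} ℚ.≤ sumTo A m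
  trunc/b^≤sumTo-A m = subst (frac (trunc m) (b ^ m) {{b^≢0 m}} ℚ.≤_) (sym (sumTo-A≡trunc/b^ m))
    (frac-mono-≤ (trunc m) (b ^ m) (trunc k) (b ^ k) {{b^≢0 m}} {{b^≢0 k}} (trunc-scaled-mono (i≤position m)))
    where k = position m

  alpha≤sumTo-A : SupLe (alpha f) (sumTo A)
  alpha≤sumTo-A n ε 0<ε with recip-below ε 0<ε
  ... | d , 1/[1+d]≤ε = m , ℚP.≤-trans (alpha-mono n (n′ ∸ n))
    (subst (λ x → alpha f x ℚ.≤ sumTo A m ℚ.+ ε) (sym (m+[n∸m]≡n (m≤m⊔n n (settle m)))) alpha[n′]≤)
    where
    m = suc d
    n′ = n ⊔ settle m
    t = trunc m
    instance
      _ = b^≢0 m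
      _ = m*n≢0 (b ^ m) (b ^ m)
    [t+1]/b^≡ : frac (suc t) (b ^ m) ≡ frac t (b ^ m) ℚ.+ frac 1 (b ^ m)
    [t+1]/b^≡ = sym (trans (frac-+ t (b ^ m) 1 (b ^ m))
      (frac-cong (t * b ^ m + 1 * b ^ m) (b ^ m * b ^ m) (suc t) (b ^ m) (ring t (b ^ m))))
      where
      ring : ∀ t x → (t * x + 1 * x) * x ≡ suc t * (x * x)
      ring = solve-∀
    1/b^≤ε : frac 1 (b ^ m) ℚ.≤ ε
    1/b^≤ε = ℚP.≤-trans (frac-mono-≤ 1 (b ^ m) 1 (suc d)
      (subst₂ _≤_ (sym (*-identityˡ (suc d))) (sym (*-identityˡ (b ^ m))) (<⇒≤ (n<m^n b (suc d) 2≤b))))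
      1/[1+d]≤ε
    alpha[n′]≤ : alpha f n′ ℚ.≤ sumTo A m ℚ.+ ε
    alpha[n′]≤ = ℚP.≤-trans (alpha≤[trunc+1]/b^ m (m≤n⊔m n (settle m)))
      (subst (ℚ._≤ sumTo A m ℚ.+ ε) (sym [t+1]/b^≡) (ℚP.+-mono-≤ (trunc/b^≤sumTo-A m) 1/b^≤ε))

  A-isSumApproxBelow : IsSumApproxBelow (alpha f) b A
  A-isSumApproxBelow = refl , (λ i → digit (position i)) , position , digit-bounds ,
    position-< 0 , (λ i _ → position-< i) , (λ { (suc i) _ → refl }) , alpha≤sumTo-A , sumTo-A≤alpha
    where
    digit-bounds : ∀ i → 1 ≤ i → 1 ≤ digit (position i) × digit (position i) < b
    digit-bounds (suc i) _ = n≢0⇒n>0 (digit-after-gap≢0 (position i)) , digit<b (position (suc i))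

  module Elementarity (graph-elem : Elem 2 (graphχ f)) where

    fχ : ℕ → ℕ → ℕ
    fχ i y = if f i ≡ᵇ y then 1 else 0

    fχ-elem : Elem₂ fχ
    fχ-elem = elem₂ graph-elem

    fχ-self : ∀ i → fχ i (f i) ≡ 1
    fχ-self i with f i ≡ᵇ f i | ≡⇒≡ᵇ (f i) (f i) refl
    ... | true | _ = refl

    fχ-≢ : ∀ i y → y ≢ f i → fχ i y ≡ 0
    fχ-≢ i y y≢fi with f i ≡ᵇ y in eq
    ... | true  = ⊥-elim (y≢fi (sym (≡ᵇ⇒≡ (f i) y (subst T (sym eq) _))))
    ... | false = refl

    -- f i when f i ≤ c, and 1 + c otherwise.
    fSearch : ℕ → ℕ → ℕ
    fSearch i c = mu (suc c) (fχ i)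

    fSearch-elem : Elem₂ fSearch
    fSearch-elem = elem₂ (app₂ search (app₁ suc-elem π₁) π₀)
      where
      search : Elem₂ (λ z i → mu z (fχ i))
      search = elem₂ (mu-elem {χ = λ y x → fχ (x fz) y} (app₂ fχ-elem π₁ π₀))

    fSearch-≤ : ∀ i c → f i ≤ c → fSearch i c ≡ f i
    fSearch-≤ i c fi≤c = mu-unique (suc c) (fχ i) (f i) (s≤s fi≤c)
      (λ fχ≡0 → 0≢1+n (trans (sym fχ≡0) (fχ-self i)))
      (λ w w<fi → fχ-≢ i w (λ w≡fi → <-irrefl w≡fi w<fi))

    fSearch-> : ∀ i c → c < f i → fSearch i c ≡ suc c
    fSearch-> i c c<fi = mu-none (suc c) (fχ i)
      (λ w w≤c → fχ-≢ i w (λ w≡fi → <-irrefl refl (≤-trans c<fi (subst (_≤ c) w≡fi (≤-pred w≤c)))))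

    H⊓ : ℕ → ℕ → ℕ
    H⊓ i c = ifz (suc c ∸ fSearch i c) c (g⊓ (fSearch i c + i) c)

    H⊓-elem : Elem₂ H⊓
    H⊓-elem = elem₂ (app₃ ifz-elem (app₂ ∸-elem (app₁ suc-elem π₁) (app₂ fSearch-elem π₀ π₁)) π₁
                                   (app₂ g⊓-elem (app₂ +-elem (app₂ fSearch-elem π₀ π₁) π₀) π₁))

    H⊓≡ : ∀ i c → 2 ≤ c → H⊓ i c ≡ H i ⊓ c
    H⊓≡ i c 2≤c with f i ≤? c
    ... | yes fi≤c rewrite fSearch-≤ i c fi≤c | +-∸-assoc 1 fi≤c = g⊓≡ (f i + i) c 2≤c
    ... | no  fi≰c rewrite fSearch-> i c (≰⇒> fi≰c) | n∸n≡0 c =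
      sym (m≥n⇒m⊓n≡n (≤-trans (<⇒≤ (≰⇒> fi≰c)) (≤-trans (m≤m+n (f i) i) (<⇒≤ (j<g (f i + i))))))

    R⊓ : ℕ → ℕ → ℕ
    R⊓ i c = pow⊓ (P⊓ i c) (H⊓ i c) c

    R⊓-elem : Elem₂ R⊓
    R⊓-elem = elem₂ (app₃ pow⊓-elem (app₂ P⊓-elem π₀ π₁) (app₂ H⊓-elem π₀ π₁) π₁)

    R⊓≡ : ∀ i c → 2 ≤ c → R⊓ i c ≡ R i ⊓ c
    R⊓≡ i c 2≤c rewrite P⊓≡ i c | H⊓≡ i c 2≤c = pow⊓-capped (P i) (H i) c (P≥2 i) (1≤H i) 2≤c

    Q⊓ : ℕ → ℕ → ℕ
    Q⊓ zero    c = R⊓ 0 c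
    Q⊓ (suc n) c = (Q⊓ n c * R⊓ (suc n) c) ⊓ c

    Q⊓≡ : ∀ n c → 2 ≤ c → Q⊓ n c ≡ Q n ⊓ c
    Q⊓≡ zero    c 2≤c = R⊓≡ 0 c 2≤c
    Q⊓≡ (suc n) c 2≤c rewrite Q⊓≡ n c 2≤c | R⊓≡ (suc n) c 2≤c =
      *-capped (Q n) (R (suc n)) c (1≤Q n) (1≤R (suc n)) 2≤c

    Q⊓≤ : ∀ n c → Q⊓ n c ≤ c
    Q⊓≤ zero    c = m⊓n≤n _ c
    Q⊓≤ (suc n) c = m⊓n≤n _ c

    Q⊓-elem : Elem₂ Q⊓
    Q⊓-elem = elem₂ (bounded-rec (λ n x → Q⊓ n (x fz)) (app₂ R⊓-elem (const-elem 0) π₀)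
      (app₂ ⊓-elem (app₂ *-elem π₁ (app₂ R⊓-elem (app₁ suc-elem π₀) π₂)) π₂) π₁
      (λ _ → refl) (λ _ _ → refl) (λ v → Q⊓≤ (v fz) (v (fs fz))))

    N⊓ : ℕ → ℕ → ℕ
    N⊓ zero    c = 1
    N⊓ (suc n) c = (N⊓ n c * R⊓ (suc n) c + Q⊓ n c) ⊓ c

    N⊓-elem : Elem₂ N⊓
    N⊓-elem = elem₂ (bounded-rec (λ n x → N⊓ n (x fz)) (const-elem 1)
      (app₂ ⊓-elem (app₂ +-elem (app₂ *-elem π₁ (app₂ R⊓-elem (app₁ suc-elem π₀) π₂)) (app₂ Q⊓-elem π₀ π₂)) π₂)
      (app₁ suc-elem π₁) (λ _ → refl) (λ _ _ → refl) (λ v → bound (v fz) (v (fs fz))))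
      where
      bound : ∀ n c → N⊓ n c ≤ suc c
      bound zero    c = s≤s z≤n
      bound (suc n) c = ≤-trans (m⊓n≤n _ c) (n≤1+n c)

    N⊓≡ : ∀ n c → 2 ≤ c → Q n ≤ c → N⊓ n c ≡ N n
    N⊓≡ zero    c _   _    = refl
    N⊓≡ (suc n) c 2≤c Q≤c with ≤-trans (m≤m*n (Q n) (R (suc n)) {{R≢0 (suc n)}}) Q≤c
    ... | Q[n]≤c
      rewrite N⊓≡ n c 2≤c Q[n]≤c | R⊓≡ (suc n) c 2≤c | Q⊓≡ n c 2≤c
            | m≤n⇒m⊓n≡m (≤-trans (m≤n*m (R (suc n)) (Q n) {{Q≢0 n}}) Q≤c) | m≤n⇒m⊓n≡m Q[n]≤c =
      m≤n⇒m⊓n≡m (≤-trans (<⇒≤ (N<Q (suc n))) Q≤c)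

    2≤QBound : ∀ m → 2 ≤ QBound m
    2≤QBound m = ≤-trans (2≤R 0) (m≤n+m (R 0) _)

    QBound-elem : Elem₁ QBound
    QBound-elem = elem₁ (app₂ +-elem (app₂ *-elem (app₂ *-elem b^m b^m) b^m) (const-elem (R 0)))
      where b^m = app₂ ^-elem (const-elem b) π₀

    -- A cap above b ^ m * Q n for every n ≤ settle m.
    stabilityCap : ℕ → ℕ
    stabilityCap m = suc (b ^ m * QBound m)

    stabilityCap-elem : Elem₁ stabilityCap
    stabilityCap-elem = elem₁ (app₁ suc-elem (app₂ *-elem (app₂ ^-elem (const-elem b) π₀) (app₁ QBound-elem π₀)))

    2≤stabilityCap : ∀ m → 2 ≤ stabilityCap m
    2≤stabilityCap m = s≤s (≤-trans (≤-trans (s≤s z≤n) (2≤QBound m)) (m≤n*m (QBound m) (b ^ m) {{b^≢0 m}}))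

    stableχ : ℕ → ℕ → ℕ
    stableχ n m = R⊓ (suc n) (stabilityCap m) ∸ b ^ m * Q⊓ n (QBound m)

    stableχ-elem : Elem₂ stableχ
    stableχ-elem = elem₂ (app₂ ∸-elem (app₂ R⊓-elem (app₁ suc-elem π₀) (app₁ stabilityCap-elem π₁))
      (app₂ *-elem (app₂ ^-elem (const-elem b) π₁) (app₂ Q⊓-elem π₀ (app₁ QBound-elem π₁))))

    stableχ≡ : ∀ n m → n ≤ settle m → stableχ n m ≡ (R (suc n) ⊓ stabilityCap m) ∸ b ^ m * Q n
    stableχ≡ n m n≤settle rewrite R⊓≡ (suc n) (stabilityCap m) (2≤stabilityCap m)
      | Q⊓≡ n (QBound m) (2≤QBound m) | m≤n⇒m⊓n≡m (Q≤QBound m n n≤settle) = refl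

    stable⇒stableχ≢0 : ∀ {n} m → n ≤ settle m → Stable m n → stableχ n m ≢ 0
    stable⇒stableχ≢0 {n} m n≤settle stable χ≡0 = <-irrefl refl (≤-trans below-both
      (m∸n≡0⇒m≤n (trans (sym (stableχ≡ n m n≤settle)) χ≡0)))
      where
      below-cap : b ^ m * Q n < stabilityCap m
      below-cap = s≤s (*-monoʳ-≤ (b ^ m) (Q≤QBound m n n≤settle))
      below-both : b ^ m * Q n < R (suc n) ⊓ stabilityCap m
      below-both = ⊓-glb stable below-cap

    ¬stable⇒stableχ≡0 : ∀ {n} m → n ≤ settle m → ¬ Stable m n → stableχ n m ≡ 0
    ¬stable⇒stableχ≡0 {n} m n≤settle unstable = trans (stableχ≡ n m n≤settle)
      (m≤n⇒m∸n≡0 (≤-trans (m⊓n≤m _ _) (≮⇒≥ unstable)))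

    settle-elem : Elem₁ settle
    settle-elem = elem₁ (e-ext (app₂ search (app₂ ^-elem (const-elem b) π₀) π₀)
                               (λ x → search≡settle (x fz)))
      where
      search : Elem₂ (λ z m → mu z (λ n → stableχ n m))
      search = elem₂ (mu-elem {χ = λ n x → stableχ n (x fz)} (app₂ stableχ-elem π₀ π₁))
      search≡settle : ∀ m → mu (b ^ m) (λ n → stableχ n m) ≡ settle m
      search≡settle m with m≤n⇒m<n∨m≡n (mu≤ (b ^ m) (λ n → R (suc n) ∸ b ^ m * Q n))
      ... | inj₁ settle<b^m = mu-unique (b ^ m) _ (settle m) settle<b^m
        (stable⇒stableχ≢0 m ≤-refl (settle-stable m))
        (λ w w<settle → ¬stable⇒stableχ≡0 m (<⇒≤ w<settle) (<settle⇒¬stable m w<settle))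
      ... | inj₂ settle≡b^m = trans (mu-none (b ^ m) _ (λ w w<b^m →
        let w<settle = subst (w <_) (sym settle≡b^m) w<b^m
        in ¬stable⇒stableχ≡0 m (<⇒≤ w<settle) (<settle⇒¬stable m w<settle))) (sym settle≡b^m)

    trunc-elem : Elem₁ trunc
    trunc-elem = elem₁ (e-ext (app₂ quot-elem (app₂ *-elem (app₂ ^-elem (const-elem b) π₀) (app₂ N⊓-elem settle′ cap))
                                               (app₂ Q⊓-elem settle′ cap))
                              (λ x → capped≡trunc (x fz)))
      where
      settle′ = app₁ settle-elem π₀
      cap = app₁ QBound-elem π₀
      capped≡trunc : ∀ m → quot (b ^ m * N⊓ (settle m) (QBound m)) (Q⊓ (settle m) (QBound m)) ≡ trunc m
      capped≡trunc m rewrite Q⊓≡ (settle m) (QBound m) (2≤QBound m)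
        | m≤n⇒m⊓n≡m (Q≤QBound m (settle m) ≤-refl)
        | N⊓≡ (settle m) (QBound m) (2≤QBound m) (Q≤QBound m (settle m) ≤-refl) =
        quot≡/ _ (Q (settle m)) {{Q≢0 (settle m)}}

    digit-elem : Elem₁ digit
    digit-elem = elem₁ (e-ext (app₃ ifz-elem π₀ (const-elem 0) (app₂ ∸-elem (app₁ trunc-elem π₀) b*trunc[m-1]))
                              (λ x → ifz≡digit (x fz)))
      where
      b*trunc[m-1] = app₂ *-elem (const-elem b) (app₁ trunc-elem (app₁ pred-elem π₀))
      ifz≡digit : ∀ m → ifz m 0 (trunc m ∸ b * trunc (pred m)) ≡ digit m
      ifz≡digit zero    = refl
      ifz≡digit (suc m) = refl

    position-elem : Elem₁ position
    position-elem = elem₁ (bounded-rec (λ i _ → position i) (const-elem 0)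
      (app₂ +-elem π₁ (app₁ suc-elem (app₂ gap (app₁ gapBound-elem π₁) π₁)))
      (app₂ *-elem (const-elem (suc gapConst)) (app₂ ^-elem (const-elem 5) π₀))
      (λ _ → refl) (λ _ _ → refl) (λ v → position≤positionBound (v fz)))
      where
      gapBound-elem : Elem₁ gapBound
      gapBound-elem = elem₁ (app₂ +-elem (app₂ *-elem (const-elem 3) π₀) (const-elem gapConst))
      gap : Elem₂ (λ z k → mu z (λ L → digit (k + suc L)))
      gap = elem₂ (mu-elem {χ = λ L x → digit (x fz + suc L)} (app₁ digit-elem (app₂ +-elem π₁ (app₁ suc-elem π₀))))

    A-code : ℕ → ℕ
    A-code i = ifz i 0 (fracCode (digit (position i)) (b ^ position i))

    A-code≡ : ∀ i → A-code i ≡ codeℚ (A i)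
    A-code≡ zero    = refl
    A-code≡ (suc i) = sym (trans (cong codeℚ (frac-*-recip D (b ^ k) {{b^≢0 k}}))
      (codeℚ-frac D (b ^ k) {{b^≢0 k}} (n≢0⇒n>0 (digit-after-gap≢0 (position i)))))
      where
      k = position (suc i)
      D = digit k

    A-elem : Elementary₁ (λ i → codeℚ (A i))
    A-elem = e-ext (app₃ ifz-elem π₀ (const-elem 0)
                      (app₂ fracCode-elem (app₁ digit-elem (app₁ position-elem π₀))
                                          (app₂ ^-elem (const-elem b) (app₁ position-elem π₀))))
                   (λ x → A-code≡ (x fz))

theorem1 : (f : ℕ → ℕ) → Honest f → (b : ℕ) → 2 ≤ b →
    Σ[ A ∈ (ℕ → ℚ) ] (IsSumApproxBelow (alpha f) b A × Elementary₁ (λ i → codeℚ (A i)))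
theorem1 f (f-mono , _ , graph-elem) b 2≤b = A , A-isSumApproxBelow , Elementarity.A-elem graph-elem
  where open Approximation f f-mono b 2≤b
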